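{- For positive integers $n$ and $r$, $$F_n=(a(r-1)x_1+by_1)F^*_{n-1}+rx_1y_1\sum_{j=2}^n\left(\frac{\partial}{\partial x_j}+\frac{\partial}{\partial y_j}\right)F^*_{n-1},$$ where $F^*_{n-1}$ is obtained from $F_{n-1}$ by the change of variables $x_i\to x_{i+1}$, $y_i\to y_{i+1}$ for all $1\le i\le n-1$, and $F_0=1$.
   Context: $\mathbb Z_r\wr\mathfrak S_n=\{(\kappa,\sigma):\kappa:[n]\to\mathbb Z_r,\ \sigma\in\mathfrak S_n\}$. For $\pi=(\kappa,\sigma)$ define the excedance set $\mathcal X(\pi)$ by: $i\in\mathcal X(\pi)$ iff $\sigma(i)>i$, or $\sigma(i)=i$ and $\kappa_i\ne0$; and the anti-excedance set $\mathcal Y(\pi)$ by: $\sigma(i)\in\mathcal Y(\pi)$ iff $\sigma(i)<i$, or $\sigma(i)=i$ and $\kappa_i=0$. A cycle of $\sigma$ is a zero cycle if $\kappa_i=0$ for its maximal element $i$, otherwise a non-zero cycle; $\mathrm{zc}(\pi)$ and $\mathrm{nc}(\pi)$ are the numbers of zero and non-zero cycles. With $a,b$ parameters and variables $\mathbf x=(x_1,\ldots,x_n)$, $\mathbf y=(y_1,\ldots,y_n)$, $$F_n=F_{n,r}(\mathbf x,\mathbf y,a,b)=\sum_{\pi\in\mathbb Z_r\wr\mathfrak S_n}a^{\mathrm{nc}(\pi)}b^{\mathrm{zc}(\pi)}\prod_{i\in\mathcal X(\pi)}x_i\prod_{j\in\mathcal Y(\pi)}y_j.$$ -}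

module Defs where

open import Data.Nat as ℕ using (ℕ; zero; suc; _+_; _*_; _∸_)
open import Data.Fin as Fin using (Fin; toℕ)
open import Data.Fin.Properties using (all?; any?)
open import Data.Vec using (Vec; []; _∷_; lookup)
open import Data.List using (List; []; _∷_; [_]; map; concatMap; filter; length; allFin; foldr)
open import Data.Product using (_×_; _,_; ∃)
open import Data.Sum using (_⊎_)
open import Relation.Binary.PropositionalEquality using (_≡_; _≢_)
open import Relation.Nullary using (Dec; yes; no; ¬_; ¬?)
open import Relation.Nullary.Decidable using (_×-dec_; _⊎-dec_; _→-dec_)

-- Formal polynomials in the variables a, b, x₁..xₙ, y₁..yₙ with ℕ
-- coefficients, represented by their coefficient function on monomials.
-- (Variable xᵢ for i = 1..n is indexed by Fin n, i.e. x₁ ↔ Fin.zero.)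

record Mono (n : ℕ) : Set where
  constructor mono
  field
    ea : ℕ
    eb : ℕ
    ex : Fin n → ℕ
    ey : Fin n → ℕ
open Mono public

Poly : ℕ → Set
Poly n = Mono n → ℕ

_≈M_ : ∀ {n} → Mono n → Mono n → Set
m ≈M m' = (ea m ≡ ea m') × (eb m ≡ eb m')
        × (∀ i → ex m i ≡ ex m' i) × (∀ i → ey m i ≡ ey m' i)

_≟M_ : ∀ {n} (m m' : Mono n) → Dec (m ≈M m')
m ≟M m' = (ea m ℕ.≟ ea m') ×-dec (eb m ℕ.≟ eb m')
        ×-dec all? (λ i → ex m i ℕ.≟ ex m' i) ×-dec all? (λ i → ey m i ℕ.≟ ey m' i)

bumpAt : ∀ {n} → Fin n → (ℕ → ℕ) → (Fin n → ℕ) → (Fin n → ℕ)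
bumpAt i g f j with i Fin.≟ j
... | yes _ = g (f j)
... | no  _ = f j

_⊕_ : ∀ {n} → Poly n → Poly n → Poly n
(p ⊕ q) m = p m + q m
infixl 6 _⊕_

scale : ∀ {n} → ℕ → Poly n → Poly n
scale c p m = c * p m

sumP : ∀ {n} → List (Poly n) → Poly n
sumP ps = foldr _⊕_ (λ _ → 0) ps

mulA : ∀ {n} → Poly n → Poly n
mulA p (mono zero    eb ex ey) = 0
mulA p (mono (suc e) eb ex ey) = p (mono e eb ex ey)

mulB : ∀ {n} → Poly n → Poly n
mulB p (mono ea zero    ex ey) = 0
mulB p (mono ea (suc e) ex ey) = p (mono ea e ex ey)

mulX : ∀ {n} → Fin n → Poly n → Poly n
mulX i p (mono ea eb ex ey) with ex i
... | zero  = 0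
... | suc _ = p (mono ea eb (bumpAt i ℕ.pred ex) ey)

mulY : ∀ {n} → Fin n → Poly n → Poly n
mulY i p (mono ea eb ex ey) with ey i
... | zero  = 0
... | suc _ = p (mono ea eb ex (bumpAt i ℕ.pred ey))

dX : ∀ {n} → Fin n → Poly n → Poly n
dX i p (mono ea eb ex ey) = suc (ex i) * p (mono ea eb (bumpAt i suc ex) ey)

dY : ∀ {n} → Fin n → Poly n → Poly n
dY i p (mono ea eb ex ey) = suc (ey i) * p (mono ea eb ex (bumpAt i suc ey))

-- change of variables xᵢ → xᵢ₊₁, yᵢ → yᵢ₊₁ (1 ≤ i ≤ n-1):
-- the result does not involve x₁, y₁.
shiftVars : ∀ {n} → Poly n → Poly (suc n)
shiftVars p (mono ea eb ex ey) with ex Fin.zero | ey Fin.zero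
... | zero | zero = p (mono ea eb (λ i → ex (Fin.suc i)) (λ i → ey (Fin.suc i)))
... | _    | _    = 0

-- Colored permutations ℤ_r ≀ 𝔖_n: pairs (κ , σ), κ : [n] → ℤ_r, σ ∈ 𝔖_n.
-- Functions on Fin n are given as vectors of their values.

allVecs : ∀ {A : Set} → List A → (n : ℕ) → List (Vec A n)
allVecs xs zero    = [ [] ]
allVecs xs (suc n) = concatMap (λ x → map (x ∷_) (allVecs xs n)) xs

IsPerm : ∀ {n} → Vec (Fin n) n → Set
IsPerm σ = ∀ i j → lookup σ i ≡ lookup σ j → i ≡ j

isPerm? : ∀ {n} (σ : Vec (Fin n) n) → Dec (IsPerm σ)
isPerm? σ = all? (λ i → all? (λ j → (lookup σ i Fin.≟ lookup σ j) →-dec (i Fin.≟ j)))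

ColPerm : ℕ → ℕ → Set
ColPerm n r = Vec (Fin r) n × Vec (Fin n) n

colPerms : (n r : ℕ) → List (ColPerm n r)
colPerms n r = concatMap (λ κ → map (κ ,_) (filter isPerm? (allVecs (allFin n) n)))
                         (allVecs (allFin r) n)

iter : ∀ {A : Set} → (A → A) → ℕ → A → A
iter f zero    x = x
iter f (suc k) x = f (iter f k x)

-- i is the maximal element of its cycle of σ (the cycle of i is
-- {σ^k(i) : 0 ≤ k < n})
IsCycleMax : ∀ {n} → Vec (Fin n) n → Fin n → Set
IsCycleMax {n} σ i = ∀ (k : Fin n) → iter (lookup σ) (toℕ k) i Fin.≤ i

isCycleMax? : ∀ {n} (σ : Vec (Fin n) n) (i : Fin n) → Dec (IsCycleMax σ i)
isCycleMax? σ i = all? (λ k → iter (lookup σ) (toℕ k) i Fin.≤? i)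

count : ∀ {n} {P : Fin n → Set} → (∀ i → Dec (P i)) → ℕ
count {n} P? = length (filter P? (allFin n))

-- number of non-zero cycles (κ ≠ 0 at the cycle maximum)
nc : ∀ {n r} → ColPerm n r → ℕ
nc (κ , σ) = count (λ i → isCycleMax? σ i ×-dec ¬? (toℕ (lookup κ i) ℕ.≟ 0))

-- number of zero cycles (κ = 0 at the cycle maximum)
zc : ∀ {n r} → ColPerm n r → ℕ
zc (κ , σ) = count (λ i → isCycleMax? σ i ×-dec (toℕ (lookup κ i) ℕ.≟ 0))

InX : ∀ {n r} → ColPerm n r → Fin n → Set
InX (κ , σ) i = (i Fin.< lookup σ i) ⊎ ((lookup σ i ≡ i) × (toℕ (lookup κ i) ≢ 0))

inX? : ∀ {n r} (π : ColPerm n r) (i : Fin n) → Dec (InX π i)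
inX? (κ , σ) i = (i Fin.<? lookup σ i)
               ⊎-dec ((lookup σ i Fin.≟ i) ×-dec ¬? (toℕ (lookup κ i) ℕ.≟ 0))

InY : ∀ {n r} → ColPerm n r → Fin n → Set
InY (κ , σ) j = ∃ λ i → (lookup σ i ≡ j)
                  × ((lookup σ i Fin.< i) ⊎ ((lookup σ i ≡ i) × (toℕ (lookup κ i) ≡ 0)))

inY? : ∀ {n r} (π : ColPerm n r) (j : Fin n) → Dec (InY π j)
inY? (κ , σ) j = any? (λ i → (lookup σ i Fin.≟ j)
                   ×-dec ((lookup σ i Fin.<? i)
                          ⊎-dec ((lookup σ i Fin.≟ i) ×-dec (toℕ (lookup κ i) ℕ.≟ 0))))

indicator : ∀ {P : Set} → Dec P → ℕ
indicator (yes _) = 1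
indicator (no  _) = 0

weight : ∀ {n r} → ColPerm n r → Mono n
weight π = mono (nc π) (zc π) (λ i → indicator (inX? π i)) (λ j → indicator (inY? π j))

F : (n r : ℕ) → Poly n
F n r m = length (filter (λ π → weight π ≟M m) (colPerms n r))

RHS : (k r : ℕ) → Poly (suc k)
RHS k r =
  (scale (r ∸ 1) (mulA (mulX Fin.zero G)) ⊕ mulB (mulY Fin.zero G))
  ⊕ scale r (mulX Fin.zero (mulY Fin.zero
       (sumP (map (λ j → dX (Fin.suc j) G ⊕ dY (Fin.suc j) G) (allFin k)))))
  where
    G : Poly (suc k)
    G = shiftVars (F k r)

-- Every π ∈ ℤ_r ≀ 𝔖_{k+1} arises exactly once by inserting a new
-- smallest letter 0, of some color c, into some π' ∈ ℤ_r ≀ 𝔖_k whose letters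
-- are shifted up by one: either as a fixed point, or into a cycle right after
-- a letter suc p.  Shifting does not change the statistics of π', and the
-- insertion changes them locally: a fixed point adds a zero cycle and y₁
-- (c = 0) or a non-zero cycle and x₁ (c ≠ 0); an insertion after suc p adds
-- x₁ y₁ and removes suc p from 𝒳 and σ'(p)+1 from 𝒴, where exactly one of
-- the two removals has an effect, giving the term ∂/∂x_{p+1} or the term
-- ∂/∂y_{σ'(p)+1}.  So the insertions into one π' produce the right-hand side
-- operator applied to the monomial of π', and linearity of that operator
-- finishes the proof.

module Submission where

open import Defs
open import Data.Empty using (⊥-elim)
open import Data.Fin as Fin using (Fin; toℕ; fromℕ<; punchOut)
open import Data.Fin.Properties
  using (suc-injective; pigeonhole; toℕ-fromℕ<; toℕ<n; punchOut-injective; punchIn-punchOut; injective⇒≤; any?; <-cmp; <-asym; <-irrefl)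
open import Data.List using (List; []; _∷_; map; concatMap; filter; length; allFin; replicate; _++_; cartesianProduct; cartesianProductWith)
open import Data.List.Membership.Propositional using (_∈_)
open import Data.List.Membership.Propositional.Properties
  using (∈-cartesianProductWith⁺; ∈-cartesianProduct⁺; ∈-cartesianProduct⁻; ∈-filter⁺; ∈-filter⁻; ∈-map⁺; ∈-map⁻; ∈-allFin)
open import Data.List.Membership.Propositional.Properties.WithK using (unique∧set⇒bag)
open import Data.List.Properties using (map-++; length-tabulate; map-tabulate)
open import Data.List.Relation.Binary.BagAndSetEquality using (∼bag⇒↭)
open import Data.List.Relation.Binary.Permutation.Propositional.Properties using (map⁺)
import Data.List.Relation.Unary.All as All
import Data.List.Relation.Unary.AllPairs as AllPairs
open import Data.List.Relation.Unary.Any using (here; there)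
open import Data.List.Relation.Unary.Unique.Propositional using (Unique)
import Data.List.Relation.Unary.Unique.Propositional.Properties as Unique
open import Data.Nat as ℕ using (ℕ; zero; suc; _+_; _*_; _∸_; _≤_; z≤n; s≤s; s≤s⁻¹; s<s⁻¹)
open import Data.Nat.Induction using (<-rec)
open import Data.Nat.ListAction using (sum)
open import Data.Nat.ListAction.Properties using (sum-++; sum-↭)
open import Data.Nat.Properties
  using (0≢1+n; +-comm; +-identityʳ; *-identityˡ; *-zeroʳ; *-distribˡ-+; 1+n≰n; m∸n+n≡m; +-monoʳ-<; ≮⇒≥; n<1+n; ≤-trans; m<1+n⇒m≤n)
  renaming (suc-injective to ℕ-suc-injective)
open import Data.Nat.Solver using (module +-*-Solver)
open import Data.Product using (_×_; _,_; proj₁; proj₂; ∃; <_,_>)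
open import Data.Sum using (_⊎_; inj₁; inj₂)
open import Data.Vec using (Vec; []; _∷_; lookup; tabulate)
import Data.Vec.Functional as VF
open import Data.Vec.Properties using (lookup∘tabulate; tabulate∘lookup; tabulate-cong; ∷-injectiveˡ; ∷-injectiveʳ)
open import Function using (_∘_; id; _⇔_; mk⇔; Equivalence)
import Function.Properties.Equivalence as ⇔
open import Relation.Binary.Definitions using (tri<; tri≈; tri>)
open import Relation.Binary.PropositionalEquality
  using (_≡_; _≢_; _≗_; refl; sym; trans; cong; cong₂; subst; module ≡-Reasoning)
open import Relation.Nullary using (Dec; yes; no; ¬_; ¬?)
open import Relation.Nullary.Decidable using (_×-dec_)

open Equivalence using (to; from)

sumL : {A : Set} → (A → ℕ) → List A → ℕ
sumL h xs = sum (map h xs)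

sumL-cong : {A : Set} {h g : A → ℕ} (xs : List A) →
            (∀ x → x ∈ xs → h x ≡ g x) → sumL h xs ≡ sumL g xs
sumL-cong []       e = refl
sumL-cong (x ∷ xs) e = cong₂ _+_ (e x (here refl)) (sumL-cong xs (λ y y∈ → e y (there y∈)))

sumL-congᵖ : {A : Set} {h g : A → ℕ} (xs : List A) → (∀ x → h x ≡ g x) → sumL h xs ≡ sumL g xs
sumL-congᵖ xs e = sumL-cong xs (λ x _ → e x)

sumL-map : {A B : Set} (h : B → ℕ) (f : A → B) (xs : List A) → sumL h (map f xs) ≡ sumL (h ∘ f) xs
sumL-map h f []       = refl
sumL-map h f (x ∷ xs) = cong (h (f x) +_) (sumL-map h f xs)

sumL-++ : {A : Set} (h : A → ℕ) (xs ys : List A) → sumL h (xs ++ ys) ≡ sumL h xs + sumL h ys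
sumL-++ h xs ys = trans (cong sum (map-++ h xs ys)) (sum-++ (map h xs) (map h ys))

sumL-pairs : {A B C : Set} (h : C → ℕ) (f : A → B → C) (xs : List A) (ys : List B) →
             sumL h (cartesianProductWith f xs ys) ≡ sumL (λ x → sumL (h ∘ f x) ys) xs
sumL-pairs h f []       ys = refl
sumL-pairs h f (x ∷ xs) ys = begin
  sumL h (map (f x) ys ++ cartesianProductWith f xs ys)
    ≡⟨ sumL-++ h (map (f x) ys) _ ⟩
  sumL h (map (f x) ys) + sumL h (cartesianProductWith f xs ys)
    ≡⟨ cong₂ _+_ (sumL-map h (f x) ys) (sumL-pairs h f xs ys) ⟩
  sumL (h ∘ f x) ys + sumL (λ x → sumL (h ∘ f x) ys) xs ∎
  where open ≡-Reasoning

sumL-+ : {A : Set} (h g : A → ℕ) (xs : List A) →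
         sumL (λ x → h x + g x) xs ≡ sumL h xs + sumL g xs
sumL-+ h g []       = refl
sumL-+ h g (x ∷ xs) = trans (cong (h x + g x +_) (sumL-+ h g xs)) (interchange (h x) (g x) _ _)
  where
  open +-*-Solver
  interchange : ∀ a b c d → (a + b) + (c + d) ≡ (a + c) + (b + d)
  interchange = solve 4 (λ a b c d → (a :+ b) :+ (c :+ d) := (a :+ c) :+ (b :+ d)) refl

sumL-scale : {A : Set} (c : ℕ) (h : A → ℕ) (xs : List A) → sumL (λ x → c * h x) xs ≡ c * sumL h xs
sumL-scale c h []       = sym (*-zeroʳ c)
sumL-scale c h (x ∷ xs) = trans (cong (c * h x +_) (sumL-scale c h xs)) (sym (*-distribˡ-+ c (h x) _))

sumL-zero : {A : Set} (xs : List A) → sumL (λ _ → 0) xs ≡ 0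
sumL-zero []       = refl
sumL-zero (x ∷ xs) = sumL-zero xs

sumL-swap : {A B : Set} (h : A → B → ℕ) (xs : List A) (ys : List B) →
            sumL (λ x → sumL (h x) ys) xs ≡ sumL (λ y → sumL (λ x → h x y) xs) ys
sumL-swap h []       ys = sym (sumL-zero ys)
sumL-swap h (x ∷ xs) ys = trans (cong (sumL (h x) ys +_) (sumL-swap h xs ys))
                                (sym (sumL-+ (h x) (λ y → sumL (λ x' → h x' y) xs) ys))

sumL-const : {A : Set} (c : ℕ) (xs : List A) → sumL (λ _ → c) xs ≡ length xs * c
sumL-const c []       = refl
sumL-const c (x ∷ xs) = cong (c +_) (sumL-const c xs)

sumL-allFin : ∀ {n} (h : Fin (suc n) → ℕ) →
              sumL h (allFin (suc n)) ≡ h Fin.zero + sumL (h ∘ Fin.suc) (allFin n)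
sumL-allFin {n} h = cong (h Fin.zero +_)
  (trans (cong (sumL h) (sym (map-tabulate id Fin.suc))) (sumL-map h Fin.suc (allFin n)))

length-allFin : ∀ n → length (allFin n) ≡ n
length-allFin n = length-tabulate id

-- Two duplicate-free lists with the same members are permutations of each
-- other, so they give the same sums.
sumL-sameMembers : {A : Set} (h : A → ℕ) {xs ys : List A} → Unique xs → Unique ys →
                   (∀ {x} → x ∈ xs ⇔ x ∈ ys) → sumL h xs ≡ sumL h ys
sumL-sameMembers h uxs uys same = sum-↭ (map⁺ h (∼bag⇒↭ (unique∧set⇒bag uxs uys same)))

indicator-cong : {P Q : Set} (p : Dec P) (q : Dec Q) → P ⇔ Q → indicator p ≡ indicator q
indicator-cong (yes _) (yes _) _   = refl
indicator-cong (yes x) (no ¬y) P⇔Q = ⊥-elim (¬y (to P⇔Q x))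
indicator-cong (no ¬x) (yes y) P⇔Q = ⊥-elim (¬x (from P⇔Q y))
indicator-cong (no _)  (no _)  _   = refl

indicator-no : {P : Set} (d : Dec P) → ¬ P → indicator d ≡ 0
indicator-no (yes p) ¬p = ⊥-elim (¬p p)
indicator-no (no _)  ¬p = refl

indicator-yes : {P : Set} (d : Dec P) → P → indicator d ≡ 1
indicator-yes (yes _) p = refl
indicator-yes (no ¬p) p = ⊥-elim (¬p p)

indicator-01 : {P : Set} (d : Dec P) → indicator d ≡ 0 ⊎ indicator d ≡ 1
indicator-01 (yes _) = inj₂ refl
indicator-01 (no  _) = inj₁ refl

length-filter≡sumL : {A : Set} {P : A → Set} (P? : ∀ x → Dec (P x)) (xs : List A) →
                     length (filter P? xs) ≡ sumL (indicator ∘ P?) xs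
length-filter≡sumL P? []       = refl
length-filter≡sumL P? (x ∷ xs) with P? x
... | yes _ = cong suc (length-filter≡sumL P? xs)
... | no  _ = length-filter≡sumL P? xs

sumL-replicate : {A : Set} (h : A → ℕ) (c : ℕ) (x : A) → sumL h (replicate c x) ≡ c * h x
sumL-replicate h zero    x = refl
sumL-replicate h (suc c) x = cong (h x +_) (sumL-replicate h c x)

-- The enumerations allVecs and colPerms of Defs: they are cartesian
-- products in disguise, hence list every object exactly once.

concatMap-map≡cartesianProductWith : {A B C : Set} (f : A → B → C) (xs : List A) (ys : List B) →
  concatMap (λ x → map (f x) ys) xs ≡ cartesianProductWith f xs ys
concatMap-map≡cartesianProductWith f []       ys = refl
concatMap-map≡cartesianProductWith f (x ∷ xs) ys =
  cong (map (f x) ys ++_) (concatMap-map≡cartesianProductWith f xs ys)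

allVecs-suc : {A : Set} (xs : List A) (n : ℕ) →
              allVecs xs (suc n) ≡ cartesianProductWith _∷_ xs (allVecs xs n)
allVecs-suc xs n = concatMap-map≡cartesianProductWith _∷_ xs (allVecs xs n)

colPerms≡ : (n r : ℕ) → colPerms n r ≡
  cartesianProduct (allVecs (allFin r) n) (filter isPerm? (allVecs (allFin n) n))
colPerms≡ n r = concatMap-map≡cartesianProductWith _,_ (allVecs (allFin r) n) _

∈-allVecs : ∀ {m} n (v : Vec (Fin m) n) → v ∈ allVecs (allFin m) n
∈-allVecs zero    []      = here refl
∈-allVecs {m} (suc n) (x ∷ v) rewrite allVecs-suc (allFin m) n =
  ∈-cartesianProductWith⁺ _∷_ (∈-allFin x) (∈-allVecs n v)

unique-allVecs : (m n : ℕ) → Unique (allVecs (allFin m) n)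
unique-allVecs m zero    = All.[] AllPairs.∷ AllPairs.[]
unique-allVecs m (suc n) rewrite allVecs-suc (allFin m) n =
  Unique.cartesianProductWith⁺ _∷_ < ∷-injectiveˡ , ∷-injectiveʳ >
    (Unique.allFin⁺ m) (unique-allVecs m n)

unique-colPerms : (n r : ℕ) → Unique (colPerms n r)
unique-colPerms n r rewrite colPerms≡ n r =
  Unique.cartesianProduct⁺ (unique-allVecs r n) (Unique.filter⁺ isPerm? (unique-allVecs n n))

∈-colPerms : ∀ n r (κ : Vec (Fin r) n) (σ : Vec (Fin n) n) → IsPerm σ → (κ , σ) ∈ colPerms n r
∈-colPerms n r κ σ σ-perm rewrite colPerms≡ n r =
  ∈-cartesianProductWith⁺ _,_ (∈-allVecs n κ) (∈-filter⁺ isPerm? (∈-allVecs n σ) σ-perm)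

colPerms-isPerm : ∀ n r (π : ColPerm n r) → π ∈ colPerms n r → IsPerm (proj₂ π)
colPerms-isPerm n r (κ , σ) π∈ rewrite colPerms≡ n r =
  proj₂ (∈-filter⁻ isPerm? {xs = allVecs (allFin n) n}
          (proj₂ (∈-cartesianProduct⁻ (allVecs (allFin r) n) _ π∈)))

-- Cycle maxima.  IsCycleMax only inspects n iterates; by the pigeonhole
-- principle this is the same as inspecting the whole forward orbit.

iter-+ : {A : Set} (g : A → A) (m n : ℕ) (x : A) → iter g (m + n) x ≡ iter g m (iter g n x)
iter-+ g zero    n x = refl
iter-+ g (suc m) n x = cong g (iter-+ g m n x)

iter-cong : {A : Set} {g h : A → A} → (∀ x → g x ≡ h x) → ∀ t x → iter g t x ≡ iter h t x
iter-cong g≗h zero    x = refl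
iter-cong {g = g} g≗h (suc t) x = trans (cong g (iter-cong g≗h t x)) (g≗h _)

iter-shortcut : ∀ {n} (g : Fin n → Fin n) (i : Fin n) (t : ℕ) → n ℕ.≤ t →
                ∃ λ u → u ℕ.< t × iter g t i ≡ iter g u i
iter-shortcut {n} g i t n≤t with pigeonhole (n<1+n n) (λ a → iter g (toℕ a) i)
... | a , b , a<b , gᵃ≡gᵇ = t ∸ toℕ b + toℕ a , shorter , cut
  where
  open ≡-Reasoning
  b≤t : toℕ b ℕ.≤ t
  b≤t = ≤-trans (m<1+n⇒m≤n (toℕ<n b)) n≤t
  shorter : t ∸ toℕ b + toℕ a ℕ.< t
  shorter = subst (t ∸ toℕ b + toℕ a ℕ.<_) (m∸n+n≡m b≤t) (+-monoʳ-< (t ∸ toℕ b) a<b)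
  -- cut out the stretch between the a-th and the b-th iterate
  cut : iter g t i ≡ iter g (t ∸ toℕ b + toℕ a) i
  cut = begin
    iter g t i                              ≡⟨ cong (λ u → iter g u i) (sym (m∸n+n≡m b≤t)) ⟩
    iter g (t ∸ toℕ b + toℕ b) i            ≡⟨ iter-+ g (t ∸ toℕ b) (toℕ b) i ⟩
    iter g (t ∸ toℕ b) (iter g (toℕ b) i)   ≡⟨ cong (iter g (t ∸ toℕ b)) gᵃ≡gᵇ ⟨
    iter g (t ∸ toℕ b) (iter g (toℕ a) i)   ≡⟨ iter-+ g (t ∸ toℕ b) (toℕ a) i ⟨
    iter g (t ∸ toℕ b + toℕ a) i            ∎

iter-early : ∀ {n} (g : Fin n → Fin n) (i : Fin n) (t : ℕ) →
             ∃ λ t' → t' ℕ.< n × iter g t i ≡ iter g t' i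
iter-early {n} g i = <-rec (λ t → ∃ λ t' → t' ℕ.< n × iter g t i ≡ iter g t' i) step
  where
  step : ∀ t → (∀ {u} → u ℕ.< t → ∃ λ t' → t' ℕ.< n × iter g u i ≡ iter g t' i) →
         ∃ λ t' → t' ℕ.< n × iter g t i ≡ iter g t' i
  step t rec with t ℕ.<? n
  ... | yes t<n = t , t<n , refl
  ... | no  t≮n with iter-shortcut g i t (≮⇒≥ t≮n)
  ...   | u , u<t , gᵗ≡gᵘ with rec u<t
  ...     | t' , t'<n , gᵘ≡gᵗ' = t' , t'<n , trans gᵗ≡gᵘ gᵘ≡gᵗ'

IsOrbitMax : ∀ {n} → (Fin n → Fin n) → Fin n → Set
IsOrbitMax g i = ∀ t → iter g t i Fin.≤ i

isCycleMax⇔isOrbitMax : ∀ {n} (σ : Vec (Fin n) n) (i : Fin n) →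
                        IsCycleMax σ i ⇔ IsOrbitMax (lookup σ) i
isCycleMax⇔isOrbitMax σ i = mk⇔ all-iterates (λ max k → max (toℕ k))
  where
  all-iterates : IsCycleMax σ i → IsOrbitMax (lookup σ) i
  all-iterates cm t with iter-early (lookup σ) i t
  ... | t' , t'<n , e =
    subst (Fin._≤ i) (sym (trans e (cong (λ u → iter (lookup σ) u i) (sym (toℕ-fromℕ< t'<n)))))
          (cm (fromℕ< t'<n))

IsOrbitMax-cong : ∀ {n} {g h : Fin n → Fin n} → (∀ x → g x ≡ h x) → ∀ i → IsOrbitMax g i → IsOrbitMax h i
IsOrbitMax-cong g≗h i max t = subst (Fin._≤ i) (iter-cong g≗h t i) (max t)

-- Insertion of a new smallest letter 0 into σ' ∈ 𝔖ₖ acting on the letters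
-- suc i: for o = zero the letter 0 becomes a fixed point, for o = suc p it
-- is inserted into the cycle of suc p, right after suc p.
insertion : ∀ {k} → Vec (Fin k) k → Fin (suc k) → Fin (suc k) → Fin (suc k)
insertion σ' Fin.zero    Fin.zero    = Fin.zero
insertion σ' Fin.zero    (Fin.suc i) = Fin.suc (lookup σ' i)
insertion σ' (Fin.suc p) Fin.zero    = Fin.suc (lookup σ' p)
insertion σ' (Fin.suc p) (Fin.suc i) with i Fin.≟ p
... | yes _ = Fin.zero
... | no  _ = Fin.suc (lookup σ' i)

insertσ : ∀ {k} → Vec (Fin k) k → Fin (suc k) → Vec (Fin (suc k)) (suc k)
insertσ σ' o = tabulate (insertion σ' o)

lookup-insertσ : ∀ {k} (σ' : Vec (Fin k) k) o i → lookup (insertσ σ' o) i ≡ insertion σ' o i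
lookup-insertσ σ' o = lookup∘tabulate (insertion σ' o)

insertion-at : ∀ {k} (σ' : Vec (Fin k) k) p → insertion σ' (Fin.suc p) (Fin.suc p) ≡ Fin.zero
insertion-at σ' p with p Fin.≟ p
... | yes _   = refl
... | no  p≢p = ⊥-elim (p≢p refl)

insertion-off : ∀ {k} (σ' : Vec (Fin k) k) p i → i ≢ p →
                insertion σ' (Fin.suc p) (Fin.suc i) ≡ Fin.suc (lookup σ' i)
insertion-off σ' p i i≢p with i Fin.≟ p
... | yes i≡p = ⊥-elim (i≢p i≡p)
... | no  _   = refl

-- Orbits of the old letters: starting from suc j, the inserted permutation
-- visits exactly the successors of the σ'-orbit of j, and possibly 0.
module InsertionOrbits {k} (σ' : Vec (Fin k) k) where

  orbit-fixed : ∀ t j → iter (insertion σ' Fin.zero) t (Fin.suc j) ≡ Fin.suc (iter (lookup σ') t j)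
  orbit-fixed zero    j = refl
  orbit-fixed (suc t) j rewrite orbit-fixed t j = refl

  orbit-zero-fixed : ∀ t → iter (insertion σ' Fin.zero) t Fin.zero ≡ Fin.zero
  orbit-zero-fixed zero    = refl
  orbit-zero-fixed (suc t) rewrite orbit-zero-fixed t = refl

  module _ (p : Fin k) where
    private
      ins : Fin (suc k) → Fin (suc k)
      ins = insertion σ' (Fin.suc p)

    orbit-down : ∀ j t → (∃ λ s → iter ins t (Fin.suc j) ≡ Fin.suc (iter (lookup σ') s j))
                       ⊎ (iter ins t (Fin.suc j) ≡ Fin.zero × ∃ λ s → iter (lookup σ') s j ≡ p)
    orbit-down j zero = inj₁ (0 , refl)
    orbit-down j (suc t) with orbit-down j t
    ... | inj₂ (at0 , s , σˢj≡p) rewrite at0 =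
      inj₁ (suc s , cong (λ x → Fin.suc (lookup σ' x)) (sym σˢj≡p))
    ... | inj₁ (s , atσˢj) rewrite atσˢj with iter (lookup σ') s j Fin.≟ p
    ...   | yes σˢj≡p = inj₂ (refl , s , σˢj≡p)
    ...   | no  _     = inj₁ (suc s , refl)

    -- every shifted σ'-iterate is visited (possibly after a detour through 0)
    orbit-up : ∀ j s → ∃ λ t → iter ins t (Fin.suc j) ≡ Fin.suc (iter (lookup σ') s j)
    orbit-up j zero = 0 , refl
    orbit-up j (suc s) with orbit-up j s
    ... | t , e with iter (lookup σ') s j Fin.≟ p
    ...   | yes σˢj≡p = suc (suc t) , (begin
      ins (ins (iter ins t (Fin.suc j)))              ≡⟨ cong (λ x → ins (ins x)) e ⟩
      ins (ins (Fin.suc (iter (lookup σ') s j)))      ≡⟨ cong (λ x → ins (ins (Fin.suc x))) σˢj≡p ⟩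
      ins (ins (Fin.suc p))                           ≡⟨ cong ins (insertion-at σ' p) ⟩
      Fin.suc (lookup σ' p)                           ≡⟨ cong (λ x → Fin.suc (lookup σ' x)) σˢj≡p ⟨
      Fin.suc (lookup σ' (iter (lookup σ') s j))      ∎)
      where open ≡-Reasoning
    ...   | no  σˢj≢p = suc t , trans (cong ins e) (insertion-off σ' p _ σˢj≢p)

  orbitMax-suc : ∀ o j → IsOrbitMax (insertion σ' o) (Fin.suc j) ⇔ IsOrbitMax (lookup σ') j
  orbitMax-suc Fin.zero j = mk⇔
    (λ max t → s≤s⁻¹ (subst (Fin._≤ Fin.suc j) (orbit-fixed t j) (max t)))
    (λ max t → subst (Fin._≤ Fin.suc j) (sym (orbit-fixed t j)) (s≤s (max t)))
  orbitMax-suc (Fin.suc p) j = mk⇔ down up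
    where
    down : IsOrbitMax (insertion σ' (Fin.suc p)) (Fin.suc j) → IsOrbitMax (lookup σ') j
    down max s with orbit-up p j s
    ... | t , e = s≤s⁻¹ (subst (Fin._≤ Fin.suc j) e (max t))
    up : IsOrbitMax (lookup σ') j → IsOrbitMax (insertion σ' (Fin.suc p)) (Fin.suc j)
    up max t with orbit-down p j t
    ... | inj₁ (s , e)   = subst (Fin._≤ Fin.suc j) (sym e) (s≤s (max s))
    ... | inj₂ (at0 , _) = subst (Fin._≤ Fin.suc j) (sym at0) z≤n

  orbitMax-zero : ∀ o → IsOrbitMax (insertion σ' o) Fin.zero ⇔ o ≡ Fin.zero
  orbitMax-zero Fin.zero    = mk⇔ (λ _ → refl)
    (λ _ t → subst (Fin._≤ Fin.zero {k}) (sym (orbit-zero-fixed t)) z≤n)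
  orbitMax-zero (Fin.suc p) = mk⇔ (λ max → ⊥-elim (suc≰zero (max 1))) (λ ())
    where
    suc≰zero : ∀ {n} → ¬ suc n ℕ.≤ 0
    suc≰zero ()

  isCycleMax⇔orbitMax : ∀ o i → IsCycleMax (insertσ σ' o) i ⇔ IsOrbitMax (insertion σ' o) i
  isCycleMax⇔orbitMax o i = ⇔.trans (isCycleMax⇔isOrbitMax (insertσ σ' o) i)
    (mk⇔ (IsOrbitMax-cong (lookup-insertσ σ' o) i) (IsOrbitMax-cong (λ x → sym (lookup-insertσ σ' o x)) i))

  insertσ-cycleMax-suc : ∀ o j → IsCycleMax (insertσ σ' o) (Fin.suc j) ⇔ IsCycleMax σ' j
  insertσ-cycleMax-suc o j = ⇔.trans (isCycleMax⇔orbitMax o (Fin.suc j))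
    (⇔.trans (orbitMax-suc o j) (⇔.sym (isCycleMax⇔isOrbitMax σ' j)))

  insertσ-cycleMax-zero : ∀ o → IsCycleMax (insertσ σ' o) Fin.zero ⇔ o ≡ Fin.zero
  insertσ-cycleMax-zero o = ⇔.trans (isCycleMax⇔orbitMax o Fin.zero) (orbitMax-zero o)

vec-ext : {A : Set} {n : ℕ} {u v : Vec A n} → (∀ i → lookup u i ≡ lookup v i) → u ≡ v
vec-ext {u = u} {v} u≗v = trans (sym (tabulate∘lookup u)) (trans (tabulate-cong u≗v) (tabulate∘lookup v))

injective⇒surjective : ∀ {n} (f : Fin n → Fin n) → (∀ i j → f i ≡ f j → i ≡ j) →
                       ∀ y → ∃ λ x → f x ≡ y
injective⇒surjective {zero}  f f-inj ()
injective⇒surjective {suc m} f f-inj y with any? (λ x → f x Fin.≟ y)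
... | yes hit = hit
... | no  miss = ⊥-elim (1+n≰n (injective⇒≤ {f = avoid-y} avoid-y-injective))
  where
  y≢f : ∀ x → y ≢ f x
  y≢f x y≡fx = miss (x , sym y≡fx)
  -- f misses y, so it factors through Fin m
  avoid-y : Fin (suc m) → Fin m
  avoid-y x = punchOut (y≢f x)
  avoid-y-injective : ∀ {a b} → avoid-y a ≡ avoid-y b → a ≡ b
  avoid-y-injective {a} {b} e = f-inj a b (punchOut-injective (y≢f a) (y≢f b) e)

-- Every permutation σ of Fin (suc k) is an insertion: o is the letter
-- mapped to 0, and σ' is σ with the letter 0 short-circuited in its cycle
-- and the remaining letters shifted down.
module Removal {k} (σ : Vec (Fin (suc k)) (suc k)) (σ-perm : IsPerm σ) where
  private
    s : Fin (suc k) → Fin (suc k)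
    s = lookup σ

  bypass : (x : Fin (suc k)) → Dec (s x ≡ Fin.zero) → Fin (suc k)
  bypass x (yes _) = s Fin.zero
  bypass x (no  _) = s x

  skip : Fin (suc k) → Fin (suc k)
  skip x = bypass x (s x Fin.≟ Fin.zero)

  s-suc≢s-zero : ∀ i → s (Fin.suc i) ≢ s Fin.zero
  s-suc≢s-zero i e with σ-perm _ _ e
  ... | ()

  skip-suc≢zero : ∀ i → Fin.zero ≢ skip (Fin.suc i)
  skip-suc≢zero i with s (Fin.suc i) Fin.≟ Fin.zero
  ... | yes to0 = λ 0≡s0 → s-suc≢s-zero i (trans to0 0≡s0)
  ... | no  ¬to0 = λ 0≡s → ¬to0 (sym 0≡s)

  skip-off0 : ∀ x → s x ≢ Fin.zero → skip x ≡ s x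
  skip-off0 x ¬to0 with s x Fin.≟ Fin.zero
  ... | yes to0 = ⊥-elim (¬to0 to0)
  ... | no  _   = refl

  skip-to0 : ∀ x → s x ≡ Fin.zero → skip x ≡ s Fin.zero
  skip-to0 x to0 with s x Fin.≟ Fin.zero
  ... | yes _    = refl
  ... | no  ¬to0 = ⊥-elim (¬to0 to0)

  skip-suc-injective : ∀ i j → skip (Fin.suc i) ≡ skip (Fin.suc j) → i ≡ j
  skip-suc-injective i j e
    with s (Fin.suc i) Fin.≟ Fin.zero | s (Fin.suc j) Fin.≟ Fin.zero
  ... | yes i↦0 | yes j↦0 = suc-injective (σ-perm _ _ (trans i↦0 (sym j↦0)))
  ... | yes _   | no  _   = ⊥-elim (s-suc≢s-zero j (sym e))
  ... | no  _   | yes _   = ⊥-elim (s-suc≢s-zero i e)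
  ... | no  _   | no  _   = suc-injective (σ-perm _ _ e)

  σ' : Vec (Fin k) k
  σ' = tabulate (λ i → punchOut (skip-suc≢zero i))

  suc-σ' : ∀ i → Fin.suc (lookup σ' i) ≡ skip (Fin.suc i)
  suc-σ' i = trans (cong Fin.suc (lookup∘tabulate _ i)) (punchIn-punchOut (skip-suc≢zero i))

  σ'-perm : IsPerm σ'
  σ'-perm i j e = skip-suc-injective i j
    (trans (sym (suc-σ' i)) (trans (cong Fin.suc e) (suc-σ' j)))

  s-suc-off0 : ∀ {o} i → s o ≡ Fin.zero → Fin.suc i ≢ o → s (Fin.suc i) ≢ Fin.zero
  s-suc-off0 i o↦0 i≢o i↦0 = i≢o (σ-perm _ _ (trans i↦0 (sym o↦0)))

  insertion-removal : ∀ o → s o ≡ Fin.zero → ∀ x → insertion σ' o x ≡ s x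
  insertion-removal Fin.zero    o↦0 Fin.zero    = sym o↦0
  insertion-removal Fin.zero    o↦0 (Fin.suc i) =
    trans (suc-σ' i) (skip-off0 _ (s-suc-off0 i o↦0 (λ ())))
  insertion-removal (Fin.suc p) o↦0 Fin.zero    = trans (suc-σ' p) (skip-to0 _ o↦0)
  insertion-removal (Fin.suc p) o↦0 (Fin.suc i) with i Fin.≟ p
  ... | yes refl = sym o↦0
  ... | no  i≢p  = trans (suc-σ' i) (skip-off0 _ (s-suc-off0 i o↦0 (λ e → i≢p (suc-injective e))))

  removal : ∃ λ σ' → ∃ λ o → IsPerm σ' × insertσ σ' o ≡ σ
  removal with injective⇒surjective s σ-perm Fin.zero
  ... | o , o↦0 = σ' , o , σ'-perm ,
    vec-ext (λ x → trans (lookup-insertσ σ' o x) (insertion-removal o o↦0 x))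

-- Insertion preserves permutations (the omitted cases have an equation
-- between Fin.zero and Fin.suc as hypothesis) ...
insertion-injective : ∀ {k} (σ' : Vec (Fin k) k) → IsPerm σ' → ∀ o i j →
                      insertion σ' o i ≡ insertion σ' o j → i ≡ j
insertion-injective σ' σ'-perm Fin.zero Fin.zero    Fin.zero    e = refl
insertion-injective σ' σ'-perm Fin.zero (Fin.suc i) (Fin.suc j) e =
  cong Fin.suc (σ'-perm i j (suc-injective e))
insertion-injective σ' σ'-perm (Fin.suc p) Fin.zero Fin.zero e = refl
insertion-injective σ' σ'-perm (Fin.suc p) Fin.zero (Fin.suc j) e with j Fin.≟ p
... | no  j≢p = ⊥-elim (j≢p (sym (σ'-perm p j (suc-injective e))))
insertion-injective σ' σ'-perm (Fin.suc p) (Fin.suc i) Fin.zero e with i Fin.≟ p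
... | no  i≢p = ⊥-elim (i≢p (σ'-perm i p (suc-injective e)))
insertion-injective σ' σ'-perm (Fin.suc p) (Fin.suc i) (Fin.suc j) e with i Fin.≟ p | j Fin.≟ p
... | yes i≡p | yes j≡p = cong Fin.suc (trans i≡p (sym j≡p))
... | no  _   | no  _   = cong Fin.suc (σ'-perm i j (suc-injective e))

insertσ-perm : ∀ {k} (σ' : Vec (Fin k) k) → IsPerm σ' → ∀ o → IsPerm (insertσ σ' o)
insertσ-perm σ' σ'-perm o i j e = insertion-injective σ' σ'-perm o i j
  (trans (sym (lookup-insertσ σ' o i)) (trans e (lookup-insertσ σ' o j)))

insertion-injective₂ : ∀ {k} (σ₁ σ₂ : Vec (Fin k) k) o₁ o₂ →
                       (∀ i → insertion σ₁ o₁ i ≡ insertion σ₂ o₂ i) → o₁ ≡ o₂ × σ₁ ≡ σ₂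
insertion-injective₂ σ₁ σ₂ Fin.zero Fin.zero same =
  refl , vec-ext (λ i → suc-injective (same (Fin.suc i)))
insertion-injective₂ σ₁ σ₂ Fin.zero (Fin.suc p) same with trans (same (Fin.suc p)) (insertion-at σ₂ p)
... | ()
insertion-injective₂ σ₁ σ₂ (Fin.suc p) Fin.zero same with trans (sym (insertion-at σ₁ p)) (same (Fin.suc p))
... | ()
insertion-injective₂ σ₁ σ₂ (Fin.suc p₁) (Fin.suc p₂) same with p₁ Fin.≟ p₂
... | no p₁≢p₂ with trans (sym (insertion-at σ₁ p₁)) (trans (same (Fin.suc p₁)) (insertion-off σ₂ p₂ p₁ p₁≢p₂))
...   | ()
insertion-injective₂ σ₁ σ₂ (Fin.suc p) (Fin.suc p) same | yes refl = refl , vec-ext agree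
  where
  agree : ∀ i → lookup σ₁ i ≡ lookup σ₂ i
  agree i with i Fin.≟ p
  ... | yes refl = suc-injective (same Fin.zero)
  ... | no  i≢p  = suc-injective (trans (sym (insertion-off σ₁ p i i≢p))
                                        (trans (same (Fin.suc i)) (insertion-off σ₂ p i i≢p)))

count-suc : ∀ {n} {P : Fin (suc n) → Set} (P? : ∀ i → Dec (P i)) →
            count P? ≡ indicator (P? Fin.zero) + count (P? ∘ Fin.suc)
count-suc {n} P? = trans (length-filter≡sumL P? (allFin (suc n)))
  (trans (sumL-allFin (indicator ∘ P?))
         (cong (indicator (P? Fin.zero) +_) (sym (length-filter≡sumL (P? ∘ Fin.suc) (allFin n)))))

count-cong : ∀ {n} {P Q : Fin n → Set} (P? : ∀ i → Dec (P i)) (Q? : ∀ i → Dec (Q i)) →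
             (∀ i → P i ⇔ Q i) → count P? ≡ count Q?
count-cong {n} P? Q? P⇔Q = trans (length-filter≡sumL P? (allFin n))
  (trans (sumL-congᵖ (allFin n) (λ i → indicator-cong (P? i) (Q? i) (P⇔Q i)))
         (sym (length-filter≡sumL Q? (allFin n))))

×-⇔ˡ : {A B C : Set} → A ⇔ B → (A × C) ⇔ (B × C)
×-⇔ˡ A⇔B = mk⇔ (λ (a , c) → to A⇔B a , c) (λ (b , c) → from A⇔B b , c)

-- The excedance and anti-excedance conditions at position i, with the value
-- v = σ(i) and the color c = κᵢ abstracted (InX and InY of Defs are built
-- from them); shifting all letters up by one does not change them.
ExcAt : ∀ {n} → Fin n → Fin n → ℕ → Set
ExcAt v i c = (i Fin.< v) ⊎ ((v ≡ i) × (c ≢ 0))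

AntiExcAt : ∀ {n} → Fin n → Fin n → ℕ → Fin n → Set
AntiExcAt v i c j = (v ≡ j) × ((v Fin.< i) ⊎ ((v ≡ i) × (c ≡ 0)))

ExcAt-suc : ∀ {n} (v i : Fin n) c → ExcAt (Fin.suc v) (Fin.suc i) c ⇔ ExcAt v i c
ExcAt-suc v i c = mk⇔
  (λ { (inj₁ i<v) → inj₁ (s<s⁻¹ i<v) ; (inj₂ (v≡i , c≢0)) → inj₂ (suc-injective v≡i , c≢0) })
  (λ { (inj₁ i<v) → inj₁ (s≤s i<v)   ; (inj₂ (v≡i , c≢0)) → inj₂ (cong Fin.suc v≡i , c≢0) })

AntiExcAt-suc : ∀ {n} (v i : Fin n) c j →
                AntiExcAt (Fin.suc v) (Fin.suc i) c (Fin.suc j) ⇔ AntiExcAt v i c j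
AntiExcAt-suc v i c j = mk⇔
  (λ { (v≡j , inj₁ v<i)        → suc-injective v≡j , inj₁ (s<s⁻¹ v<i)
     ; (v≡j , inj₂ (v≡i , c≡0)) → suc-injective v≡j , inj₂ (suc-injective v≡i , c≡0) })
  (λ { (v≡j , inj₁ v<i)        → cong Fin.suc v≡j , inj₁ (s≤s v<i)
     ; (v≡j , inj₂ (v≡i , c≡0)) → cong Fin.suc v≡j , inj₂ (cong Fin.suc v≡i , c≡0) })

clearAt : ∀ {n} → Fin n → (Fin n → ℕ) → Fin n → ℕ
clearAt p = bumpAt p (λ _ → 0)

insertC : ∀ {k r} → ColPerm k r → Fin r → Fin (suc k) → ColPerm (suc k) r
insertC (κ' , σ') c o = (c ∷ κ' , insertσ σ' o)

-- In the
-- names below, "fix" refers to o = zero and "cycle" to o = suc p; the new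
-- letter is "zero", an old letter is "suc", and "at"/"off" distinguish the
-- letters touched by the insertion from the others.
module ColoredInsertion {k r} (κ' : Vec (Fin r) k) (σ' : Vec (Fin k) k) (c : Fin r) where

  π' : ColPerm k r
  π' = κ' , σ'

  π : Fin (suc k) → ColPerm (suc k) r
  π = insertC π' c

  col : Fin (suc k) → ℕ
  col i = toℕ (lookup (c ∷ κ') i)

  exc⇔ : ∀ o i → InX (π o) i ⇔ ExcAt (insertion σ' o i) i (col i)
  exc⇔ o i = mk⇔ (subst (λ v → ExcAt v i (col i)) (lookup-insertσ σ' o i))
                 (subst (λ v → ExcAt v i (col i)) (sym (lookup-insertσ σ' o i)))

  antiExc⇔ : ∀ o j → InY (π o) j ⇔ (∃ λ i → AntiExcAt (insertion σ' o i) i (col i) j)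
  antiExc⇔ o j = mk⇔
    (λ (i , h) → i , subst (λ v → AntiExcAt v i (col i) j) (lookup-insertσ σ' o i) h)
    (λ (i , h) → i , subst (λ v → AntiExcAt v i (col i) j) (sym (lookup-insertσ σ' o i)) h)

  exc-fix-zero : InX (π Fin.zero) Fin.zero ⇔ (toℕ c ≢ 0)
  exc-fix-zero = ⇔.trans (exc⇔ Fin.zero Fin.zero) (mk⇔ (λ { (inj₁ ()) ; (inj₂ (_ , c≢0)) → c≢0 })
                                                         (λ c≢0 → inj₂ (refl , c≢0)))

  exc-cycle-zero : ∀ p → InX (π (Fin.suc p)) Fin.zero
  exc-cycle-zero p = from (exc⇔ (Fin.suc p) Fin.zero) (inj₁ (s≤s z≤n))

  exc-fix-suc : ∀ i → InX (π Fin.zero) (Fin.suc i) ⇔ InX π' i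
  exc-fix-suc i = ⇔.trans (exc⇔ Fin.zero (Fin.suc i)) (ExcAt-suc _ i _)

  exc-cycle-at : ∀ p → ¬ InX (π (Fin.suc p)) (Fin.suc p)
  exc-cycle-at p h with subst (λ v → ExcAt v (Fin.suc p) _) (insertion-at σ' p)
                              (to (exc⇔ (Fin.suc p) (Fin.suc p)) h)
  ... | inj₁ ()
  ... | inj₂ (() , _)

  exc-cycle-off : ∀ p i → i ≢ p → InX (π (Fin.suc p)) (Fin.suc i) ⇔ InX π' i
  exc-cycle-off p i i≢p = ⇔.trans (exc⇔ (Fin.suc p) (Fin.suc i))
    (⇔.trans (mk⇔ (subst (λ v → ExcAt v _ _) off) (subst (λ v → ExcAt v _ _) (sym off))) (ExcAt-suc _ i _))
    where
    off : insertion σ' (Fin.suc p) (Fin.suc i) ≡ Fin.suc (lookup σ' i)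
    off = insertion-off σ' p i i≢p

  antiExc-fix-zero : InY (π Fin.zero) Fin.zero ⇔ (toℕ c ≡ 0)
  antiExc-fix-zero = ⇔.trans (antiExc⇔ Fin.zero Fin.zero) (mk⇔ only-zero (λ c≡0 → Fin.zero , refl , inj₂ (refl , c≡0)))
    where
    only-zero : (∃ λ i → AntiExcAt (insertion σ' Fin.zero i) i (col i) Fin.zero) → toℕ c ≡ 0
    only-zero (Fin.zero , _ , inj₁ ())
    only-zero (Fin.zero , _ , inj₂ (_ , c≡0)) = c≡0
    only-zero (Fin.suc i , () , _)

  antiExc-cycle-zero : ∀ p → InY (π (Fin.suc p)) Fin.zero
  antiExc-cycle-zero p = from (antiExc⇔ (Fin.suc p) Fin.zero)
    (Fin.suc p , insertion-at σ' p , inj₁ (subst (Fin._< Fin.suc p) (sym (insertion-at σ' p)) (s≤s z≤n)))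

  antiExc-fix-suc : ∀ j → InY (π Fin.zero) (Fin.suc j) ⇔ InY π' j
  antiExc-fix-suc j = ⇔.trans (antiExc⇔ Fin.zero (Fin.suc j))
    (mk⇔ down (λ (i , h) → Fin.suc i , from (AntiExcAt-suc _ _ _ _) h))
    where
    down : (∃ λ i → AntiExcAt (insertion σ' Fin.zero i) i (col i) (Fin.suc j)) → InY π' j
    down (Fin.zero , () , _)
    down (Fin.suc i , h) = i , to (AntiExcAt-suc _ _ _ _) h

  antiExc-cycle-at : IsPerm σ' → ∀ p → ¬ InY (π (Fin.suc p)) (Fin.suc (lookup σ' p))
  antiExc-cycle-at σ'-perm p h = none (to (antiExc⇔ (Fin.suc p) _) h)
    where
    none : ¬ (∃ λ i → AntiExcAt (insertion σ' (Fin.suc p) i) i (col i) (Fin.suc (lookup σ' p)))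
    none (Fin.zero , _ , inj₁ ())
    none (Fin.zero , _ , inj₂ (() , _))
    none (Fin.suc i , h) with i Fin.≟ p
    none (Fin.suc i , () , _) | yes _
    ... | no i≢p = i≢p (σ'-perm i p (suc-injective (proj₁ h)))

  antiExc-cycle-off : ∀ p j → j ≢ lookup σ' p → InY (π (Fin.suc p)) (Fin.suc j) ⇔ InY π' j
  antiExc-cycle-off p j j≢σ'p = ⇔.trans (antiExc⇔ (Fin.suc p) (Fin.suc j)) (mk⇔ down up)
    where
    down : (∃ λ i → AntiExcAt (insertion σ' (Fin.suc p) i) i (col i) (Fin.suc j)) → InY π' j
    down (Fin.zero , e , _) = ⊥-elim (j≢σ'p (sym (suc-injective e)))
    down (Fin.suc i , h) with i Fin.≟ p
    down (Fin.suc i , () , _) | yes _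
    ... | no _ = i , to (AntiExcAt-suc _ _ _ _) h
    up : InY π' j → ∃ λ i → AntiExcAt (insertion σ' (Fin.suc p) i) i (col i) (Fin.suc j)
    up (i , h) with i Fin.≟ p
    ... | yes refl = ⊥-elim (j≢σ'p (sym (proj₁ h)))
    ... | no i≢p = Fin.suc i , subst (λ v → AntiExcAt v (Fin.suc i) _ (Fin.suc j))
                                     (sym (insertion-off σ' p i i≢p)) (from (AntiExcAt-suc _ _ _ _) h)

  open InsertionOrbits σ'

  -- Old letters keep their cycle-maximum status; only the new letter may add
  -- a cycle.
  nc-insert : ∀ o → nc (π o) ≡ indicator (isCycleMax? (insertσ σ' o) Fin.zero ×-dec ¬? (toℕ c ℕ.≟ 0)) + nc π'
  nc-insert o = trans (count-suc (λ i → isCycleMax? (insertσ σ' o) i ×-dec ¬? (col i ℕ.≟ 0)))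
    (cong (_ +_) (count-cong _ (λ i → isCycleMax? σ' i ×-dec ¬? (toℕ (lookup κ' i) ℕ.≟ 0))
                               (λ j → ×-⇔ˡ (insertσ-cycleMax-suc o j))))

  zc-insert : ∀ o → zc (π o) ≡ indicator (isCycleMax? (insertσ σ' o) Fin.zero ×-dec (toℕ c ℕ.≟ 0)) + zc π'
  zc-insert o = trans (count-suc (λ i → isCycleMax? (insertσ σ' o) i ×-dec (col i ℕ.≟ 0)))
    (cong (_ +_) (count-cong _ (λ i → isCycleMax? σ' i ×-dec (toℕ (lookup κ' i) ℕ.≟ 0))
                               (λ j → ×-⇔ˡ (insertσ-cycleMax-suc o j))))

  X Y : Fin k → ℕ
  X = ex (weight π')
  Y = ey (weight π')

  weight-fixed-zero : toℕ c ≡ 0 →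
    weight (π Fin.zero) ≈M mono (nc π') (suc (zc π')) (0 VF.∷ X) (1 VF.∷ Y)
  weight-fixed-zero c≡0 =
    trans (nc-insert Fin.zero) (cong (_+ nc π') (indicator-no _ (λ (_ , c≢0) → c≢0 c≡0))) ,
    trans (zc-insert Fin.zero) (cong (_+ zc π') (indicator-yes _ (from (insertσ-cycleMax-zero Fin.zero) refl , c≡0))) ,
    (λ { Fin.zero → indicator-no _ (λ h → to exc-fix-zero h c≡0)
       ; (Fin.suc i) → indicator-cong _ _ (exc-fix-suc i) }) ,
    (λ { Fin.zero → indicator-yes _ (from antiExc-fix-zero c≡0)
       ; (Fin.suc j) → indicator-cong _ _ (antiExc-fix-suc j) })

  weight-fixed-nonzero : toℕ c ≢ 0 →
    weight (π Fin.zero) ≈M mono (suc (nc π')) (zc π') (1 VF.∷ X) (0 VF.∷ Y)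
  weight-fixed-nonzero c≢0 =
    trans (nc-insert Fin.zero) (cong (_+ nc π') (indicator-yes _ (from (insertσ-cycleMax-zero Fin.zero) refl , c≢0))) ,
    trans (zc-insert Fin.zero) (cong (_+ zc π') (indicator-no _ (λ (_ , c≡0) → c≢0 c≡0))) ,
    (λ { Fin.zero → indicator-yes _ (from exc-fix-zero c≢0)
       ; (Fin.suc i) → indicator-cong _ _ (exc-fix-suc i) }) ,
    (λ { Fin.zero → indicator-no _ (λ h → c≢0 (to antiExc-fix-zero h))
       ; (Fin.suc j) → indicator-cong _ _ (antiExc-fix-suc j) })

  weight-cycle : IsPerm σ' → ∀ p →
    weight (π (Fin.suc p)) ≈M mono (nc π') (zc π') (1 VF.∷ clearAt p X) (1 VF.∷ clearAt (lookup σ' p) Y)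
  weight-cycle σ'-perm p =
    trans (nc-insert (Fin.suc p)) (cong (_+ nc π') (indicator-no _ (λ (max , _) → not-max max))) ,
    trans (zc-insert (Fin.suc p)) (cong (_+ zc π') (indicator-no _ (λ (max , _) → not-max max))) ,
    exponentX , exponentY
    where
    not-max : ¬ IsCycleMax (insertσ σ' (Fin.suc p)) Fin.zero
    not-max max with to (insertσ-cycleMax-zero (Fin.suc p)) max
    ... | ()
    exponentX : ∀ i → indicator (inX? (π (Fin.suc p)) i) ≡ (1 VF.∷ clearAt p X) i
    exponentX Fin.zero = indicator-yes (inX? (π (Fin.suc p)) Fin.zero) (exc-cycle-zero p)
    exponentX (Fin.suc i) with p Fin.≟ i
    ... | yes refl = indicator-no _ (exc-cycle-at p)
    ... | no  p≢i  = indicator-cong _ _ (exc-cycle-off p i (λ i≡p → p≢i (sym i≡p)))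
    exponentY : ∀ j → indicator (inY? (π (Fin.suc p)) j) ≡ (1 VF.∷ clearAt (lookup σ' p) Y) j
    exponentY Fin.zero = indicator-yes _ (antiExc-cycle-zero p)
    exponentY (Fin.suc j) with lookup σ' p Fin.≟ j
    ... | yes refl = indicator-no _ (antiExc-cycle-at σ'-perm p)
    ... | no  σ'p≢j = indicator-cong _ _ (antiExc-cycle-off p j (λ j≡ → σ'p≢j (sym j≡)))

δ : ∀ {n} → Mono n → Poly n
δ w m = indicator (w ≟M m)

F≡sum : ∀ n r m → F n r m ≡ sumL (λ π → δ (weight π) m) (colPerms n r)
F≡sum n r m = length-filter≡sumL (λ π → weight π ≟M m) (colPerms n r)

Insertions : (k r : ℕ) → Set
Insertions k r = ColPerm k r × (Fin r × Fin (suc k))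

insertions : (k r : ℕ) → List (Insertions k r)
insertions k r = cartesianProduct (colPerms k r) (cartesianProduct (allFin r) (allFin (suc k)))

insertC₃ : ∀ {k r} → Insertions k r → ColPerm (suc k) r
insertC₃ (π' , c , o) = insertC π' c o

insertC₃-injective : ∀ {k r} {x y : Insertions k r} → insertC₃ x ≡ insertC₃ y → x ≡ y
insertC₃-injective {x = (κ₁ , σ₁) , c₁ , o₁} {(κ₂ , σ₂) , c₂ , o₂} same
  with ∷-injectiveˡ (cong proj₁ same) | ∷-injectiveʳ (cong proj₁ same)
     | insertion-injective₂ σ₁ σ₂ o₁ o₂ (λ i → trans (trans (sym (lookup-insertσ σ₁ o₁ i))
                                          (cong (λ π → lookup (proj₂ π) i) same)) (lookup-insertσ σ₂ o₂ i))
... | refl | refl | refl , refl = refl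

insertC₃-surjective : ∀ {k r} (π : ColPerm (suc k) r) →
                     π ∈ colPerms (suc k) r → π ∈ map insertC₃ (insertions k r)
insertC₃-surjective {k} {r} (c ∷ κ' , σ) π∈ with Removal.removal σ (colPerms-isPerm (suc k) r _ π∈)
... | σ' , o , σ'-perm , insertσ≡σ = subst (λ τ → (c ∷ κ' , τ) ∈ map insertC₃ (insertions k r)) insertσ≡σ
  (∈-map⁺ insertC₃ (∈-cartesianProduct⁺ (∈-colPerms k r κ' σ' σ'-perm)
                                       (∈-cartesianProduct⁺ (∈-allFin c) (∈-allFin o))))

insertC₃-isColPerm : ∀ {k r} (π : ColPerm (suc k) r) →
                π ∈ map insertC₃ (insertions k r) → π ∈ colPerms (suc k) r
insertC₃-isColPerm {k} {r} π π∈ with ∈-map⁻ insertC₃ π∈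
... | ((κ' , σ') , c , o) , x∈ , refl = ∈-colPerms (suc k) r _ _
  (insertσ-perm σ' (colPerms-isPerm k r _ (proj₁ (∈-cartesianProduct⁻ (colPerms k r) _ x∈))) o)

F-suc≡sum : ∀ k r m → F (suc k) r m ≡
  sumL (λ π' → sumL (λ c → sumL (λ o → δ (weight (insertC π' c o)) m) (allFin (suc k))) (allFin r)) (colPerms k r)
F-suc≡sum k r m = begin
  F (suc k) r m
    ≡⟨ F≡sum (suc k) r m ⟩
  sumL h (colPerms (suc k) r)
    ≡⟨ sumL-sameMembers h (unique-colPerms (suc k) r) unique-insertions
                         (mk⇔ (insertC₃-surjective _) (insertC₃-isColPerm _)) ⟩
  sumL h (map insertC₃ (insertions k r))
    ≡⟨ sumL-map h insertC₃ (insertions k r) ⟩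
  sumL (h ∘ insertC₃) (insertions k r)
    ≡⟨ sumL-pairs (h ∘ insertC₃) _,_ (colPerms k r) _ ⟩
  sumL (λ π' → sumL (λ co → h (insertC₃ (π' , co))) (cartesianProduct (allFin r) (allFin (suc k)))) (colPerms k r)
    ≡⟨ sumL-congᵖ (colPerms k r) (λ π' → sumL-pairs (λ co → h (insertC₃ (π' , co))) _,_ (allFin r) (allFin (suc k))) ⟩
  sumL (λ π' → sumL (λ c → sumL (λ o → h (insertC π' c o)) (allFin (suc k))) (allFin r)) (colPerms k r) ∎
  where
  open ≡-Reasoning
  h : ColPerm (suc k) r → ℕ
  h π = δ (weight π) m
  unique-insertions : Unique (map insertC₃ (insertions k r))
  unique-insertions = Unique.map⁺ insertC₃-injective
    (Unique.cartesianProduct⁺ (unique-colPerms k r) (Unique.cartesianProduct⁺ (Unique.allFin⁺ r) (Unique.allFin⁺ (suc k))))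

_≗P_ : ∀ {n} → Poly n → Poly n → Set
p ≗P q = ∀ m → p m ≡ q m
infix 4 _≗P_

ΣP : ∀ {A : Set} {n} → List A → (A → Poly n) → Poly n
ΣP xs H m = sumL (λ x → H x m) xs

sumP-map : ∀ {A : Set} {n} (g : A → Poly n) (js : List A) → sumP (map g js) ≗P ΣP js g
sumP-map g []       m = refl
sumP-map g (j ∷ js) m = cong (g j m +_) (sumP-map g js m)

record Linear {n n'} (L : Poly n → Poly n') : Set₁ where
  field
    respects : ∀ {p q} → p ≗P q → L p ≗P L q
    additive : ∀ {A : Set} (xs : List A) (H : A → Poly n) → L (ΣP xs H) ≗P ΣP xs (L ∘ H)
open Linear

-- Each coefficient of L p is a fixed multiple of one coefficient of p; the
-- basic operators (multiplication by a variable, differentiation, change of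
-- variables) all have this form.
substitution-linear : ∀ {n n'} (L : Poly n → Poly n') (c : Mono n' → ℕ) (τ : Mono n' → Mono n) →
                      (∀ p m → L p m ≡ c m * p (τ m)) → Linear L
substitution-linear L c τ L≡ .respects {p} {q} p≗q m =
  trans (L≡ p m) (trans (cong (c m *_) (p≗q (τ m))) (sym (L≡ q m)))
substitution-linear L c τ L≡ .additive xs H m = begin
  L (ΣP xs H) m                        ≡⟨ L≡ (ΣP xs H) m ⟩
  c m * sumL (λ x → H x (τ m)) xs      ≡⟨ sumL-scale (c m) (λ x → H x (τ m)) xs ⟨
  sumL (λ x → c m * H x (τ m)) xs      ≡⟨ sumL-congᵖ xs (λ x → L≡ (H x) m) ⟨
  ΣP xs (L ∘ H) m                      ∎
  where open ≡-Reasoning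

linear-∘ : ∀ {n n' n''} {L : Poly n' → Poly n''} {L' : Poly n → Poly n'} →
           Linear L → Linear L' → Linear (L ∘ L')
linear-∘ lin lin' .respects p≗q = lin .respects (lin' .respects p≗q)
linear-∘ lin lin' .additive xs H m =
  trans (lin .respects (lin' .additive xs H) m) (lin .additive xs (λ x → _) m)

linear-⊕ : ∀ {n n'} {L L' : Poly n → Poly n'} → Linear L → Linear L' → Linear (λ p → L p ⊕ L' p)
linear-⊕ lin lin' .respects p≗q m = cong₂ _+_ (lin .respects p≗q m) (lin' .respects p≗q m)
linear-⊕ lin lin' .additive xs H m =
  trans (cong₂ _+_ (lin .additive xs H m) (lin' .additive xs H m)) (sym (sumL-+ _ _ xs))

linear-scale : ∀ {n n'} (c : ℕ) {L : Poly n → Poly n'} → Linear L → Linear (scale c ∘ L)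
linear-scale c lin .respects p≗q m = cong (c *_) (lin .respects p≗q m)
linear-scale c lin .additive xs H m =
  trans (cong (c *_) (lin .additive xs H m)) (sym (sumL-scale c _ xs))

linear-sumP : ∀ {B : Set} {n n'} (js : List B) {L : B → Poly n → Poly n'} →
              (∀ j → Linear (L j)) → Linear (λ p → sumP (map (λ j → L j p) js))
linear-sumP js lin .respects {p} {q} p≗q m =
  trans (sumP-map _ js m) (trans (sumL-congᵖ js (λ j → lin j .respects p≗q m)) (sym (sumP-map _ js m)))
linear-sumP js {L} lin .additive xs H m = begin
  sumP (map (λ j → L j (ΣP xs H)) js) m        ≡⟨ sumP-map _ js m ⟩
  sumL (λ j → L j (ΣP xs H) m) js              ≡⟨ sumL-congᵖ js (λ j → lin j .additive xs H m) ⟩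
  sumL (λ j → sumL (λ x → L j (H x) m) xs) js  ≡⟨ sumL-swap (λ j x → L j (H x) m) js xs ⟩
  sumL (λ x → sumL (λ j → L j (H x) m) js) xs  ≡⟨ sumL-congᵖ xs (λ x → sumP-map _ js m) ⟨
  ΣP xs (λ x → sumP (map (λ j → L j (H x)) js)) m ∎
  where open ≡-Reasoning

linear-⊕-dist : ∀ {n n'} {L : Poly n → Poly n'} → Linear L → ∀ p q → L (p ⊕ q) ≗P L p ⊕ L q
linear-⊕-dist {L = L} lin p q m = begin
  L (p ⊕ q) m                         ≡⟨ lin .respects (λ m' → cong (p m' +_) (sym (+-identityʳ (q m')))) m ⟩
  L (ΣP (p ∷ q ∷ []) (λ f → f)) m     ≡⟨ lin .additive (p ∷ q ∷ []) (λ f → f) m ⟩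
  L p m + (L q m + 0)                 ≡⟨ cong (L p m +_) (+-identityʳ (L q m)) ⟩
  L p m + L q m                       ∎
  where open ≡-Reasoning

linear-scale-dist : ∀ {n n'} {L : Poly n → Poly n'} → Linear L → ∀ c p → L (scale c p) ≗P scale c (L p)
linear-scale-dist {L = L} lin c p m = begin
  L (scale c p) m                      ≡⟨ lin .respects (λ m' → sym (sumL-replicate (λ f → f m') c p)) m ⟩
  L (ΣP (replicate c p) (λ f → f)) m   ≡⟨ lin .additive (replicate c p) (λ f → f) m ⟩
  sumL (λ f → L f m) (replicate c p)   ≡⟨ sumL-replicate (λ f → L f m) c p ⟩
  c * L p m                            ∎
  where open ≡-Reasoning

incA incB decA decB : ∀ {n} → Mono n → Mono n
incA w = mono (suc (ea w)) (eb w) (ex w) (ey w)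
incB w = mono (ea w) (suc (eb w)) (ex w) (ey w)
decA w = mono (ℕ.pred (ea w)) (eb w) (ex w) (ey w)
decB w = mono (ea w) (ℕ.pred (eb w)) (ex w) (ey w)

incX incY decX decY : ∀ {n} → Fin n → Mono n → Mono n
incX i w = mono (ea w) (eb w) (bumpAt i suc (ex w)) (ey w)
incY i w = mono (ea w) (eb w) (ex w) (bumpAt i suc (ey w))
decX i w = mono (ea w) (eb w) (bumpAt i ℕ.pred (ex w)) (ey w)
decY i w = mono (ea w) (eb w) (ex w) (bumpAt i ℕ.pred (ey w))

tailM : ∀ {n} → Mono (suc n) → Mono n
tailM m = mono (ea m) (eb m) (ex m ∘ Fin.suc) (ey m ∘ Fin.suc)

positive : ℕ → ℕ
positive zero    = 0
positive (suc _) = 1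

bothZero : ℕ → ℕ → ℕ
bothZero zero zero = 1
bothZero _    _    = 0

mulA-coeff : ∀ {n} (p : Poly n) m → mulA p m ≡ positive (ea m) * p (decA m)
mulA-coeff p (mono zero    b x y) = refl
mulA-coeff p (mono (suc a) b x y) = sym (*-identityˡ _)

mulB-coeff : ∀ {n} (p : Poly n) m → mulB p m ≡ positive (eb m) * p (decB m)
mulB-coeff p (mono a zero    x y) = refl
mulB-coeff p (mono a (suc b) x y) = sym (*-identityˡ _)

mulX-coeff : ∀ {n} (i : Fin n) (p : Poly n) m → mulX i p m ≡ positive (ex m i) * p (decX i m)
mulX-coeff i p (mono a b x y) with x i
... | zero  = refl
... | suc _ = sym (*-identityˡ _)

mulY-coeff : ∀ {n} (i : Fin n) (p : Poly n) m → mulY i p m ≡ positive (ey m i) * p (decY i m)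
mulY-coeff i p (mono a b x y) with y i
... | zero  = refl
... | suc _ = sym (*-identityˡ _)

shiftVars-coeff : ∀ {n} (p : Poly n) m → shiftVars p m ≡ bothZero (ex m Fin.zero) (ey m Fin.zero) * p (tailM m)
shiftVars-coeff p (mono a b x y) with x Fin.zero | y Fin.zero
... | zero  | zero  = sym (*-identityˡ _)
... | zero  | suc _ = refl
... | suc _ | _     = refl

mulA-linear : ∀ {n} → Linear (mulA {n})
mulA-linear = substitution-linear mulA (positive ∘ ea) decA mulA-coeff

mulB-linear : ∀ {n} → Linear (mulB {n})
mulB-linear = substitution-linear mulB (positive ∘ eb) decB mulB-coeff

mulX-linear : ∀ {n} (i : Fin n) → Linear (mulX i)
mulX-linear i = substitution-linear (mulX i) (λ m → positive (ex m i)) (decX i) (mulX-coeff i)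

mulY-linear : ∀ {n} (i : Fin n) → Linear (mulY i)
mulY-linear i = substitution-linear (mulY i) (λ m → positive (ey m i)) (decY i) (mulY-coeff i)

dX-linear : ∀ {n} (i : Fin n) → Linear (dX i)
dX-linear i = substitution-linear (dX i) (λ m → suc (ex m i)) (incX i) (λ p m → refl)

dY-linear : ∀ {n} (i : Fin n) → Linear (dY i)
dY-linear i = substitution-linear (dY i) (λ m → suc (ey m i)) (incY i) (λ p m → refl)

shiftVars-linear : ∀ {n} → Linear (shiftVars {n})
shiftVars-linear = substitution-linear shiftVars (λ m → bothZero (ex m Fin.zero) (ey m Fin.zero)) tailM shiftVars-coeff

-- The operator of Theorem 5.4:
--   G ↦ (a(r-1)x₁ + b y₁) G + r x₁ y₁ Σⱼ (∂/∂x_{j+1} + ∂/∂y_{j+1}) G,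
-- so that RHS k r is this operator applied to F*_k = shiftVars (F k r).
rhsOperator : (k r : ℕ) → Poly (suc k) → Poly (suc k)
rhsOperator k r G = (scale (r ∸ 1) (mulA (mulX Fin.zero G)) ⊕ mulB (mulY Fin.zero G))
        ⊕ scale r (mulX Fin.zero (mulY Fin.zero (sumP (map (λ j → dX (Fin.suc j) G ⊕ dY (Fin.suc j) G) (allFin k)))))

rhsOperator-linear : ∀ k r → Linear (rhsOperator k r)
rhsOperator-linear k r =
  linear-⊕ (linear-⊕ (linear-scale (r ∸ 1) (linear-∘ mulA-linear (mulX-linear Fin.zero)))
                     (linear-∘ mulB-linear (mulY-linear Fin.zero)))
           (linear-scale r (linear-∘ (mulX-linear Fin.zero) (linear-∘ (mulY-linear Fin.zero)
             (linear-sumP (allFin k) (λ j → linear-⊕ (dX-linear (Fin.suc j)) (dY-linear (Fin.suc j)))))))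

clearX clearY : ∀ {n} → Fin n → Mono n → Mono n
clearX i w = mono (ea w) (eb w) (clearAt i (ex w)) (ey w)
clearY i w = mono (ea w) (eb w) (ex w) (clearAt i (ey w))

shiftM : ∀ {n} → Mono n → Mono (suc n)
shiftM w = mono (ea w) (eb w) (0 VF.∷ ex w) (0 VF.∷ ey w)

≈M-sym : ∀ {n} {w w' : Mono n} → w ≈M w' → w' ≈M w
≈M-sym (a , b , x , y) = sym a , sym b , sym ∘ x , sym ∘ y

≈M-trans : ∀ {n} {w w' w'' : Mono n} → w ≈M w' → w' ≈M w'' → w ≈M w''
≈M-trans (a , b , x , y) (a' , b' , x' , y') = trans a a' , trans b b' , (λ i → trans (x i) (x' i)) , (λ i → trans (y i) (y' i))

δ-cong : ∀ {n} {w w' : Mono n} → w ≈M w' → δ w ≗P δ w'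
δ-cong w≈w' m = indicator-cong (_ ≟M m) (_ ≟M m) (mk⇔ (≈M-trans (≈M-sym w≈w')) (≈M-trans w≈w'))

bumpAt-same : ∀ {n} (i : Fin n) g f → bumpAt i g f i ≡ g (f i)
bumpAt-same i g f with i Fin.≟ i
... | yes _   = refl
... | no  i≢i = ⊥-elim (i≢i refl)

bumpAt-other : ∀ {n} (i j : Fin n) g f → i ≢ j → bumpAt i g f j ≡ f j
bumpAt-other i j g f i≢j with i Fin.≟ j
... | yes i≡j = ⊥-elim (i≢j i≡j)
... | no  _   = refl

bumpAt-adjoint : ∀ {n} (i : Fin n) (g h : ℕ → ℕ) (u v : Fin n → ℕ) →
                 (u i ≡ h (v i) ⇔ g (u i) ≡ v i) → (u ≗ bumpAt i h v) ⇔ (bumpAt i g u ≗ v)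
bumpAt-adjoint i g h u v at-i = mk⇔ forth back
  where
  forth : u ≗ bumpAt i h v → bumpAt i g u ≗ v
  forth u≗ j = at j (i Fin.≟ j)
    where
    at : ∀ j → Dec (i ≡ j) → bumpAt i g u j ≡ v j
    at j (yes refl) = trans (bumpAt-same i g u) (to at-i (trans (u≗ i) (bumpAt-same i h v)))
    at j (no  i≢j)  = trans (bumpAt-other i j g u i≢j) (trans (u≗ j) (bumpAt-other i j h v i≢j))
  back : bumpAt i g u ≗ v → u ≗ bumpAt i h v
  back ≗v j = at j (i Fin.≟ j)
    where
    at : ∀ j → Dec (i ≡ j) → u j ≡ bumpAt i h v j
    at j (yes refl) = trans (from at-i (trans (sym (bumpAt-same i g u)) (≗v i))) (sym (bumpAt-same i h v))
    at j (no  i≢j)  = trans (sym (bumpAt-other i j g u i≢j)) (trans (≗v j) (sym (bumpAt-other i j h v i≢j)))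

scale-indicator : ∀ {P : Set} (c : ℕ) (d : Dec P) → (P → c ≡ 1) → c * indicator d ≡ indicator d
scale-indicator c (yes p) c≡1 rewrite c≡1 p = refl
scale-indicator c (no _)  _   = *-zeroʳ c

-- the conditions at position i in bumpAt-adjoint for multiplication and
-- for differentiation by a variable
pred⇔suc : ∀ {u n e} → n ≡ suc e → (u ≡ ℕ.pred n) ⇔ (suc u ≡ n)
pred⇔suc refl = mk⇔ (cong suc) ℕ-suc-injective

suc⇔zero : ∀ {u v} → u ≡ 1 → (u ≡ suc v) ⇔ (0 ≡ v)
suc⇔zero refl = mk⇔ ℕ-suc-injective (cong suc)

shiftVars-δ : ∀ {n} (w : Mono n) → shiftVars (δ w) ≗P δ (shiftM w)
shiftVars-δ w m = trans (shiftVars-coeff (δ w) m) (by-exponents (ex m Fin.zero) (ey m Fin.zero) refl refl)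
  where
  by-exponents : ∀ e e' → e ≡ ex m Fin.zero → e' ≡ ey m Fin.zero →
                 bothZero e e' * δ w (tailM m) ≡ δ (shiftM w) m
  by-exponents zero zero x₀ y₀ = trans (*-identityˡ _) (indicator-cong _ _ (mk⇔
    (λ (a , b , x , y) → a , b , (λ { Fin.zero → x₀ ; (Fin.suc i) → x i })
                               , (λ { Fin.zero → y₀ ; (Fin.suc i) → y i }))
    (λ (a , b , x , y) → a , b , x ∘ Fin.suc , y ∘ Fin.suc)))
  by-exponents zero (suc _) _ y₀ = sym (indicator-no _ (λ (_ , _ , _ , y) → 0≢1+n (trans (y Fin.zero) (sym y₀))))
  by-exponents (suc _) _ x₀ _ = sym (indicator-no _ (λ (_ , _ , x , _) → 0≢1+n (trans (x Fin.zero) (sym x₀))))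

mulA-δ : ∀ {n} (w : Mono n) → mulA (δ w) ≗P δ (incA w)
mulA-δ w m = trans (mulA-coeff (δ w) m) (by-exponent (ea m) refl)
  where
  by-exponent : ∀ e → e ≡ ea m → positive e * δ w (decA m) ≡ δ (incA w) m
  by-exponent zero    e≡ = sym (indicator-no _ (λ (a , _) → 0≢1+n (trans e≡ (sym a))))
  by-exponent (suc e) e≡ = trans (*-identityˡ _) (indicator-cong _ _ (mk⇔
    (λ (a , b , x , y) → to   (pred⇔suc (sym e≡)) a , b , x , y)
    (λ (a , b , x , y) → from (pred⇔suc (sym e≡)) a , b , x , y)))

mulB-δ : ∀ {n} (w : Mono n) → mulB (δ w) ≗P δ (incB w)
mulB-δ w m = trans (mulB-coeff (δ w) m) (by-exponent (eb m) refl)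
  where
  by-exponent : ∀ e → e ≡ eb m → positive e * δ w (decB m) ≡ δ (incB w) m
  by-exponent zero    e≡ = sym (indicator-no _ (λ (_ , b , _) → 0≢1+n (trans e≡ (sym b))))
  by-exponent (suc e) e≡ = trans (*-identityˡ _) (indicator-cong _ _ (mk⇔
    (λ (a , b , x , y) → a , to   (pred⇔suc (sym e≡)) b , x , y)
    (λ (a , b , x , y) → a , from (pred⇔suc (sym e≡)) b , x , y)))

mulX-δ : ∀ {n} (i : Fin n) (w : Mono n) → mulX i (δ w) ≗P δ (incX i w)
mulX-δ i w m = trans (mulX-coeff i (δ w) m) (by-exponent (ex m i) refl)
  where
  by-exponent : ∀ e → e ≡ ex m i → positive e * δ w (decX i m) ≡ δ (incX i w) m
  by-exponent zero    e≡ = sym (indicator-no _ (λ (_ , _ , x , _) →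
    0≢1+n (trans e≡ (trans (sym (x i)) (bumpAt-same i suc (ex w))))))
  by-exponent (suc e) e≡ = trans (*-identityˡ _) (indicator-cong _ _ (mk⇔
    (λ (a , b , x , y) → a , b , to   adjoint x , y)
    (λ (a , b , x , y) → a , b , from adjoint x , y)))
    where
    adjoint : (ex w ≗ bumpAt i ℕ.pred (ex m)) ⇔ (bumpAt i suc (ex w) ≗ ex m)
    adjoint = bumpAt-adjoint i suc ℕ.pred (ex w) (ex m) (pred⇔suc (sym e≡))

mulY-δ : ∀ {n} (i : Fin n) (w : Mono n) → mulY i (δ w) ≗P δ (incY i w)
mulY-δ i w m = trans (mulY-coeff i (δ w) m) (by-exponent (ey m i) refl)
  where
  by-exponent : ∀ e → e ≡ ey m i → positive e * δ w (decY i m) ≡ δ (incY i w) m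
  by-exponent zero    e≡ = sym (indicator-no _ (λ (_ , _ , _ , y) →
    0≢1+n (trans e≡ (trans (sym (y i)) (bumpAt-same i suc (ey w))))))
  by-exponent (suc e) e≡ = trans (*-identityˡ _) (indicator-cong _ _ (mk⇔
    (λ (a , b , x , y) → a , b , x , to   adjoint y)
    (λ (a , b , x , y) → a , b , x , from adjoint y)))
    where
    adjoint : (ey w ≗ bumpAt i ℕ.pred (ey m)) ⇔ (bumpAt i suc (ey w) ≗ ey m)
    adjoint = bumpAt-adjoint i suc ℕ.pred (ey w) (ey m) (pred⇔suc (sym e≡))

dX-δ : ∀ {n} (i : Fin n) (w : Mono n) → ex w i ≡ 0 ⊎ ex w i ≡ 1 →
       dX i (δ w) ≗P scale (ex w i) (δ (clearX i w))
dX-δ i w (inj₁ wᵢ≡0) m = trans (cong (suc (ex m i) *_) (indicator-no _ λ (_ , _ , x , _) →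
    0≢1+n (trans (sym wᵢ≡0) (trans (x i) (bumpAt-same i suc (ex m))))))
  (trans (*-zeroʳ (suc (ex m i))) (sym (cong (_* δ (clearX i w) m) wᵢ≡0)))
dX-δ i w (inj₂ wᵢ≡1) m = begin
  suc (ex m i) * δ w (incX i m)   ≡⟨ scale-indicator _ _ (λ (_ , _ , x , _) →
                                      trans (sym (bumpAt-same i suc (ex m))) (trans (sym (x i)) wᵢ≡1)) ⟩
  δ w (incX i m)                  ≡⟨ indicator-cong _ _ (mk⇔ (λ (a , b , x , y) → a , b , to adjoint x , y)
                                                             (λ (a , b , x , y) → a , b , from adjoint x , y)) ⟩
  δ (clearX i w) m                ≡⟨ *-identityˡ _ ⟨
  1 * δ (clearX i w) m            ≡⟨ cong (_* δ (clearX i w) m) wᵢ≡1 ⟨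
  ex w i * δ (clearX i w) m       ∎
  where
  open ≡-Reasoning
  adjoint : (ex w ≗ bumpAt i suc (ex m)) ⇔ (clearAt i (ex w) ≗ ex m)
  adjoint = bumpAt-adjoint i (λ _ → 0) suc (ex w) (ex m) (suc⇔zero wᵢ≡1)

dY-δ : ∀ {n} (i : Fin n) (w : Mono n) → ey w i ≡ 0 ⊎ ey w i ≡ 1 →
       dY i (δ w) ≗P scale (ey w i) (δ (clearY i w))
dY-δ i w (inj₁ wᵢ≡0) m = trans (cong (suc (ey m i) *_) (indicator-no _ λ (_ , _ , _ , y) →
    0≢1+n (trans (sym wᵢ≡0) (trans (y i) (bumpAt-same i suc (ey m))))))
  (trans (*-zeroʳ (suc (ey m i))) (sym (cong (_* δ (clearY i w) m) wᵢ≡0)))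
dY-δ i w (inj₂ wᵢ≡1) m = begin
  suc (ey m i) * δ w (incY i m)   ≡⟨ scale-indicator _ _ (λ (_ , _ , _ , y) →
                                      trans (sym (bumpAt-same i suc (ey m))) (trans (sym (y i)) wᵢ≡1)) ⟩
  δ w (incY i m)                  ≡⟨ indicator-cong _ _ (mk⇔ (λ (a , b , x , y) → a , b , x , to adjoint y)
                                                             (λ (a , b , x , y) → a , b , x , from adjoint y)) ⟩
  δ (clearY i w) m                ≡⟨ *-identityˡ _ ⟨
  1 * δ (clearY i w) m            ≡⟨ cong (_* δ (clearY i w) m) wᵢ≡1 ⟨
  ey w i * δ (clearY i w) m       ∎
  where
  open ≡-Reasoning
  adjoint : (ey w ≗ bumpAt i suc (ey m)) ⇔ (clearAt i (ey w) ≗ ey m)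
  adjoint = bumpAt-adjoint i (λ _ → 0) suc (ey w) (ey m) (suc⇔zero wᵢ≡1)

exc⇒¬antiExc : ∀ {k r} (κ : Vec (Fin r) k) (σ : Vec (Fin k) k) → IsPerm σ →
               ∀ p → InX (κ , σ) p → ¬ InY (κ , σ) (lookup σ p)
exc⇒¬antiExc κ σ σ-perm p p∈𝒳 (i , σi≡σp , i-cond) with σ-perm i p σi≡σp
exc⇒¬antiExc κ σ σ-perm p (inj₁ p<σp)        (i , _ , inj₁ σp<p)        | refl = <-asym p<σp σp<p
exc⇒¬antiExc κ σ σ-perm p (inj₁ p<σp)        (i , _ , inj₂ (σp≡p , _))  | refl = <-irrefl (sym σp≡p) p<σp
exc⇒¬antiExc κ σ σ-perm p (inj₂ (σp≡p , _))  (i , _ , inj₁ σp<p)        | refl = <-irrefl σp≡p σp<p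
exc⇒¬antiExc κ σ σ-perm p (inj₂ (_ , κp≢0))  (i , _ , inj₂ (_ , κp≡0))  | refl = κp≢0 κp≡0

¬exc⇒antiExc : ∀ {k r} (κ : Vec (Fin r) k) (σ : Vec (Fin k) k) →
               ∀ p → ¬ InX (κ , σ) p → InY (κ , σ) (lookup σ p)
¬exc⇒antiExc κ σ p p∉𝒳 with <-cmp p (lookup σ p)
... | tri< p<σp _ _ = ⊥-elim (p∉𝒳 (inj₁ p<σp))
... | tri> _ _ σp<p = p , refl , inj₁ σp<p
... | tri≈ _ p≡σp _ with toℕ (lookup κ p) ℕ.≟ 0
...   | yes κp≡0 = p , refl , inj₂ (sym p≡σp , κp≡0)
...   | no  κp≢0 = ⊥-elim (p∉𝒳 (inj₂ (sym p≡σp , κp≢0)))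

sumL-permute : ∀ {k} (σ : Vec (Fin k) k) → IsPerm σ → (g : Fin k → ℕ) →
               sumL (g ∘ lookup σ) (allFin k) ≡ sumL g (allFin k)
sumL-permute {k} σ σ-perm g = trans (sym (sumL-map g (lookup σ) (allFin k)))
  (sumL-sameMembers g (Unique.map⁺ (σ-perm _ _) (Unique.allFin⁺ k)) (Unique.allFin⁺ k)
    (λ {x} → mk⇔ (λ _ → ∈-allFin x) (λ _ → hit x)))
  where
  hit : ∀ x → x ∈ map (lookup σ) (allFin k)
  hit x with injective⇒surjective (lookup σ) σ-perm x
  ... | p , refl = ∈-map⁺ (lookup σ) (∈-allFin p)

∷-cong : ∀ {n} (e : ℕ) {f g : Fin n → ℕ} → f ≗ g → (e VF.∷ f) ≗ (e VF.∷ g)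
∷-cong e f≗g Fin.zero    = refl
∷-cong e f≗g (Fin.suc i) = f≗g i

bumpAt-cong : ∀ {n} (i : Fin n) (g : ℕ → ℕ) {f f' : Fin n → ℕ} → f ≗ f' → bumpAt i g f ≗ bumpAt i g f'
bumpAt-cong i g f≗f' j with i Fin.≟ j
... | yes _ = cong g (f≗f' j)
... | no  _ = f≗f' j

bumpAt-∷ : ∀ {n} (p : Fin n) (g : ℕ → ℕ) (e : ℕ) (f : Fin n → ℕ) →
           bumpAt (Fin.suc p) g (e VF.∷ f) ≗ (e VF.∷ bumpAt p g f)
bumpAt-∷ p g e f Fin.zero = bumpAt-other (Fin.suc p) Fin.zero g (e VF.∷ f) (λ ())
bumpAt-∷ p g e f (Fin.suc i) = at (p Fin.≟ i)
  where
  at : Dec (p ≡ i) → bumpAt (Fin.suc p) g (e VF.∷ f) (Fin.suc i) ≡ bumpAt p g f i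
  at (yes refl) = trans (bumpAt-same (Fin.suc p) g _) (sym (bumpAt-same p g f))
  at (no  p≢i)  = trans (bumpAt-other (Fin.suc p) (Fin.suc i) g _ (p≢i ∘ suc-injective))
                        (sym (bumpAt-other p i g f p≢i))

-- multiplying F* by x₁ (or y₁) marks the first position
mark-first : ∀ {n} (f : Fin n → ℕ) → bumpAt Fin.zero suc (0 VF.∷ f) ≗ (1 VF.∷ f)
mark-first f Fin.zero    = bumpAt-same Fin.zero suc (0 VF.∷ f)
mark-first f (Fin.suc i) = bumpAt-other Fin.zero (Fin.suc i) suc (0 VF.∷ f) (λ ())

-- x₁ y₁ ∂/∂x_{p+1} F* marks the first position and clears position p+1
mark-first-clear : ∀ {n} (p : Fin n) (f : Fin n → ℕ) →
                   bumpAt Fin.zero suc (clearAt (Fin.suc p) (0 VF.∷ f)) ≗ (1 VF.∷ clearAt p f)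
mark-first-clear p f i =
  trans (bumpAt-cong Fin.zero suc (bumpAt-∷ p (λ _ → 0) 0 f) i) (mark-first (clearAt p f) i)

clearAt-noop : ∀ {n} (p : Fin n) (f : Fin n → ℕ) → f p ≡ 0 → clearAt p f ≗ f
clearAt-noop p f fp≡0 i with p Fin.≟ i
... | yes refl = sym fp≡0
... | no  _    = refl

module InsertionsInto {k r'} (κ' : Vec (Fin (suc r')) k) (σ' : Vec (Fin k) k) (σ'-perm : IsPerm σ') where

  r : ℕ
  r = suc r'

  π' : ColPerm k r
  π' = (κ' , σ')

  w : Mono k
  w = weight π'

  -- the monomial of π' in F*
  S : Mono (suc k)
  S = shiftM w

  X Y : Fin k → ℕ
  X = ex w
  Y = ey w

  -- the monomials on the right-hand side of the theorem, for G = δ S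
  A₁ B₁ : Mono (suc k)
  A₁ = incA (incX Fin.zero S)
  B₁ = incB (incY Fin.zero S)

  Cx Cy : Fin k → Mono (suc k)
  Cx j = incX Fin.zero (incY Fin.zero (clearX (Fin.suc j) S))
  Cy j = incX Fin.zero (incY Fin.zero (clearY (Fin.suc j) S))

  -- the x₁ y₁ Σⱼ (∂/∂x_{j+1} + ∂/∂y_{j+1}) part at F* = δ S
  T : Poly (suc k)
  T m = sumL (λ j → X j * δ (Cx j) m + Y j * δ (Cy j) m) (allFin k)

  x₁y₁ : Linear {suc k} (mulX Fin.zero ∘ mulY Fin.zero)
  x₁y₁ = linear-∘ (mulX-linear Fin.zero) (mulY-linear Fin.zero)

  x₁y₁-δ : ∀ (U : Mono (suc k)) → mulX Fin.zero (mulY Fin.zero (δ U)) ≗P δ (incX Fin.zero (incY Fin.zero U))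
  x₁y₁-δ U m = trans (mulX-linear Fin.zero .respects (mulY-δ Fin.zero U) m) (mulX-δ Fin.zero (incY Fin.zero U) m)

  rhsOperator-δ : ∀ m → rhsOperator k r (shiftVars (δ w)) m ≡ (r' * δ A₁ m + δ B₁ m) + r * T m
  rhsOperator-δ m = trans (rhsOperator-linear k r .respects (shiftVars-δ w) m)
    (cong₂ _+_ (cong₂ _+_ (cong (r' *_) (trans (mulA-linear .respects (mulX-δ Fin.zero S) m) (mulA-δ _ m)))
                          (trans (mulB-linear .respects (mulY-δ Fin.zero S) m) (mulB-δ _ m)))
               (cong (r *_) derivatives))
    where
    D : Fin k → Poly (suc k)
    D j = dX (Fin.suc j) (δ S) ⊕ dY (Fin.suc j) (δ S)
    term : ∀ j → mulX Fin.zero (mulY Fin.zero (D j)) m ≡ X j * δ (Cx j) m + Y j * δ (Cy j) m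
    term j = begin
      mulX Fin.zero (mulY Fin.zero (D j)) m
        ≡⟨ linear-⊕-dist x₁y₁ _ _ m ⟩
      mulX Fin.zero (mulY Fin.zero (dX (Fin.suc j) (δ S))) m + mulX Fin.zero (mulY Fin.zero (dY (Fin.suc j) (δ S))) m
        ≡⟨ cong₂ _+_ (x₁y₁ .respects (dX-δ (Fin.suc j) S (indicator-01 _)) m)
                     (x₁y₁ .respects (dY-δ (Fin.suc j) S (indicator-01 _)) m) ⟩
      mulX Fin.zero (mulY Fin.zero (scale (X j) (δ (clearX (Fin.suc j) S)))) m
        + mulX Fin.zero (mulY Fin.zero (scale (Y j) (δ (clearY (Fin.suc j) S)))) m
        ≡⟨ cong₂ _+_ (trans (linear-scale-dist x₁y₁ (X j) (δ (clearX (Fin.suc j) S)) m)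
                            (cong (X j *_) (x₁y₁-δ (clearX (Fin.suc j) S) m)))
                     (trans (linear-scale-dist x₁y₁ (Y j) (δ (clearY (Fin.suc j) S)) m)
                            (cong (Y j *_) (x₁y₁-δ (clearY (Fin.suc j) S) m))) ⟩
      X j * δ (Cx j) m + Y j * δ (Cy j) m ∎
      where open ≡-Reasoning
    derivatives : mulX Fin.zero (mulY Fin.zero (sumP (map D (allFin k)))) m ≡ T m
    derivatives = trans (x₁y₁ .respects (sumP-map D (allFin k)) m)
                        (trans (x₁y₁ .additive (allFin k) D m) (sumL-congᵖ (allFin k) term))

  -- Insertion as a fixed point: color 0 gives b y₁ F*, the r' other colors a x₁ F*.
  fixed-sum : ∀ m → sumL (λ c → δ (weight (insertC π' c Fin.zero)) m) (allFin r) ≡ δ B₁ m + r' * δ A₁ m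
  fixed-sum m = begin
    sumL (λ c → δ (weight (insertC π' c Fin.zero)) m) (allFin r)
      ≡⟨ sumL-allFin (λ c → δ (weight (insertC π' c Fin.zero)) m) ⟩
    δ (weight (insertC π' Fin.zero Fin.zero)) m + sumL (λ c → δ (weight (insertC π' (Fin.suc c) Fin.zero)) m) (allFin r')
      ≡⟨ cong₂ _+_ (δ-cong (≈M-trans (ColoredInsertion.weight-fixed-zero κ' σ' Fin.zero refl) zero-color) m)
                   (sumL-congᵖ (allFin r') λ c →
                      δ-cong (≈M-trans (ColoredInsertion.weight-fixed-nonzero κ' σ' (Fin.suc c) (λ ())) nonzero-color) m) ⟩
    δ B₁ m + sumL (λ _ → δ A₁ m) (allFin r')
      ≡⟨ cong (δ B₁ m +_) (trans (sumL-const (δ A₁ m) (allFin r')) (cong (_* δ A₁ m) (length-allFin r'))) ⟩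
    δ B₁ m + r' * δ A₁ m ∎
    where
    open ≡-Reasoning
    zero-color : mono (nc π') (suc (zc π')) (0 VF.∷ X) (1 VF.∷ Y) ≈M B₁
    zero-color = refl , refl , (λ _ → refl) , (λ i → sym (mark-first Y i))
    nonzero-color : mono (suc (nc π')) (zc π') (1 VF.∷ X) (0 VF.∷ Y) ≈M A₁
    nonzero-color = refl , refl , (λ i → sym (mark-first X i)) , (λ _ → refl)

  -- Insertion into a cycle right after suc p (any color).
  M : Fin k → Mono (suc k)
  M p = mono (nc π') (zc π') (1 VF.∷ clearAt p X) (1 VF.∷ clearAt (lookup σ' p) Y)

  -- It is the x₁y₁∂/∂x_{p+1} term if p ∈ 𝒳, and the x₁y₁∂/∂y_{σ'(p)+1} term otherwise.
  M-split : ∀ p m → δ (M p) m ≡ X p * δ (Cx p) m + Y (lookup σ' p) * δ (Cy (lookup σ' p)) m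
  M-split p m with inX? π' p
  ... | yes p∈𝒳 = trans (δ-cong M≈Cx m)
    (sym (trans (cong₂ _+_ (*-identityˡ _) (cong (_* δ (Cy (lookup σ' p)) m) σp∉𝒴)) (+-identityʳ _)))
    where
    σp∉𝒴 : Y (lookup σ' p) ≡ 0
    σp∉𝒴 = indicator-no _ (exc⇒¬antiExc κ' σ' σ'-perm p p∈𝒳)
    M≈Cx : M p ≈M Cx p
    M≈Cx = refl , refl , (λ i → sym (mark-first-clear p X i))
         , (λ i → trans (∷-cong 1 (clearAt-noop (lookup σ' p) Y σp∉𝒴) i) (sym (mark-first Y i)))
  ... | no p∉𝒳 = trans (δ-cong M≈Cy m) (sym (trans (cong (_* δ (Cy (lookup σ' p)) m) σp∈𝒴) (*-identityˡ _)))
    where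
    σp∈𝒴 : Y (lookup σ' p) ≡ 1
    σp∈𝒴 = indicator-yes _ (¬exc⇒antiExc κ' σ' p p∉𝒳)
    M≈Cy : M p ≈M Cy (lookup σ' p)
    M≈Cy = refl , refl
         , (λ i → trans (∷-cong 1 (clearAt-noop p X (indicator-no _ p∉𝒳)) i) (sym (mark-first X i)))
         , (λ i → sym (mark-first-clear (lookup σ' p) Y i))

  cycle-sum : ∀ m → sumL (λ p → δ (M p) m) (allFin k) ≡ T m
  cycle-sum m = begin
    sumL (λ p → δ (M p) m) (allFin k)
      ≡⟨ sumL-congᵖ (allFin k) (λ p → M-split p m) ⟩
    sumL (λ p → X p * δ (Cx p) m + Y (lookup σ' p) * δ (Cy (lookup σ' p)) m) (allFin k)
      ≡⟨ sumL-+ _ _ (allFin k) ⟩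
    sumL (λ p → X p * δ (Cx p) m) (allFin k) + sumL (λ p → Y (lookup σ' p) * δ (Cy (lookup σ' p)) m) (allFin k)
      ≡⟨ cong (sumL (λ p → X p * δ (Cx p) m) (allFin k) +_) (sumL-permute σ' σ'-perm (λ j → Y j * δ (Cy j) m)) ⟩
    sumL (λ p → X p * δ (Cx p) m) (allFin k) + sumL (λ j → Y j * δ (Cy j) m) (allFin k)
      ≡⟨ sumL-+ _ _ (allFin k) ⟨
    T m ∎
    where open ≡-Reasoning

  insertions-sum : ∀ m → sumL (λ c → sumL (λ o → δ (weight (insertC π' c o)) m) (allFin (suc k))) (allFin r)
                         ≡ rhsOperator k r (shiftVars (δ w)) m
  insertions-sum m = begin
    sumL (λ c → sumL (λ o → δ (weight (insertC π' c o)) m) (allFin (suc k))) (allFin r)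
      ≡⟨ sumL-congᵖ (allFin r) (λ c → sumL-allFin (λ o → δ (weight (insertC π' c o)) m)) ⟩
    sumL (λ c → δ (weight (insertC π' c Fin.zero)) m + cycles c) (allFin r)
      ≡⟨ sumL-+ _ cycles (allFin r) ⟩
    sumL (λ c → δ (weight (insertC π' c Fin.zero)) m) (allFin r) + sumL cycles (allFin r)
      ≡⟨ cong₂ _+_ (fixed-sum m) (sumL-congᵖ (allFin r) cycles≡) ⟩
    (δ B₁ m + r' * δ A₁ m) + sumL (λ _ → T m) (allFin r)
      ≡⟨ cong₂ _+_ (+-comm (δ B₁ m) _) (trans (sumL-const (T m) (allFin r)) (cong (_* T m) (length-allFin r))) ⟩
    (r' * δ A₁ m + δ B₁ m) + r * T m
      ≡⟨ rhsOperator-δ m ⟨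
    rhsOperator k r (shiftVars (δ w)) m ∎
    where
    open ≡-Reasoning
    cycles : Fin r → ℕ
    cycles c = sumL (λ p → δ (weight (insertC π' c (Fin.suc p))) m) (allFin k)
    cycles≡ : ∀ c → cycles c ≡ T m
    cycles≡ c = trans (sumL-congᵖ (allFin k) (λ p → δ-cong (ColoredInsertion.weight-cycle κ' σ' c σ'-perm p) m))
                      (cycle-sum m)

theorem5p4 : (k r : ℕ) → 1 ≤ r → (m : Mono (suc k)) → F (suc k) r m ≡ RHS k r m
theorem5p4 k zero () m
theorem5p4 k r@(suc _) _ m = begin
  F (suc k) r m
    ≡⟨ F-suc≡sum k r m ⟩
  sumL (λ π' → sumL (λ c → sumL (λ o → δ (weight (insertC π' c o)) m) (allFin (suc k))) (allFin r)) (colPerms k r)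
    ≡⟨ sumL-cong (colPerms k r) (λ { (κ' , σ') π'∈ →
         InsertionsInto.insertions-sum κ' σ' (colPerms-isPerm k r _ π'∈) m }) ⟩
  sumL (λ π' → rhsOperator k r (shiftVars (δ (weight π'))) m) (colPerms k r)
    ≡⟨ rhsOperator∘shiftVars .additive (colPerms k r) (δ ∘ weight) m ⟨
  rhsOperator k r (shiftVars (ΣP (colPerms k r) (δ ∘ weight))) m
    ≡⟨ rhsOperator∘shiftVars .respects (λ m' → sym (F≡sum k r m')) m ⟩
  RHS k r m ∎
  where
  open ≡-Reasoning
  rhsOperator∘shiftVars : Linear (rhsOperator k r ∘ shiftVars)
  rhsOperator∘shiftVars = linear-∘ (rhsOperator-linear k r) shiftVars-linear
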